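{- For every integer $n\ge1$, the number of walks of length $n$ with steps in $\{ -2,-1,+1,+2\}$ starting at altitude $0$, ending at altitude $1$ and having altitude strictly greater than $0$ at every point after the start equals $$\frac1n\sum_{k=1}^n(-1)^{k+1}\binom{2k-2}{k-1}\binom{2n}{n-k}=\frac1n\sum_{i=0}^n\binom{n}{i}\binom{n}{2n+1-3i}.$$
   Context: A walk moves one unit right and $s$ units vertically for each step $s$. Binomial coefficients $\binom{a}{b}$ are $0$ if $b<0$ or $b>a$. -}

module Defs where

open import Data.Nat as ℕ using (ℕ; zero; suc)
open import Data.Nat.Combinatorics using (_C_)
open import Data.Nat.ListAction renaming (sum to sumℕ)
open import Data.Integer as ℤ using (ℤ; +_; -[1+_]; _<_; _<?_)
import Data.Integer.Properties as ℤP
open import Data.List as List using (List; []; _∷_; map; concatMap; filter; length; foldr; upTo)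
open import Data.Vec using (Vec; []; _∷_)
open import Data.Product using (_×_; _,_)
open import Data.Unit using (⊤; tt)
open import Relation.Nullary using (Dec; yes; no)
open import Relation.Nullary.Decidable using (_×-dec_)
open import Relation.Binary.PropositionalEquality using (_≡_)

data Step : Set where
  m2 m1 p1 p2 : Step

allSteps : List Step
allSteps = m2 ∷ m1 ∷ p1 ∷ p2 ∷ []

val : Step → ℤ
val m2 = ℤ.- (+ 2)
val m1 = ℤ.- (+ 1)
val p1 = + 1
val p2 = + 2

Walk : ℕ → Set
Walk n = Vec Step n

endAlt : ∀ {n} → ℤ → Walk n → ℤ
endAlt h []      = h
endAlt h (s ∷ w) = endAlt (h ℤ.+ val s) w

PosAfterStart : ∀ {n} → ℤ → Walk n → Set
PosAfterStart h []      = ⊤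
PosAfterStart h (s ∷ w) = (+ 0 < h ℤ.+ val s) × PosAfterStart (h ℤ.+ val s) w

posAfterStart? : ∀ {n} (h : ℤ) (w : Walk n) → Dec (PosAfterStart h w)
posAfterStart? h []      = yes tt
posAfterStart? h (s ∷ w) = (+ 0 <? h ℤ.+ val s) ×-dec posAfterStart? (h ℤ.+ val s) w

Good : ∀ {n} → Walk n → Set
Good w = PosAfterStart (+ 0) w × endAlt (+ 0) w ≡ + 1

good? : ∀ {n} (w : Walk n) → Dec (Good w)
good? w = posAfterStart? (+ 0) w ×-dec (endAlt (+ 0) w ℤ.≟ + 1)

allWalks : (n : ℕ) → List (Walk n)
allWalks zero    = [] ∷ []
allWalks (suc n) = concatMap (λ s → map (s ∷_) (allWalks n)) allSteps

numWalks : ℕ → ℕ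
numWalks n = length (filter good? (allWalks n))

-- Binomial coefficient with integer lower index: 0 if b < 0 (and 0 if b > a via _C_).
binomℤ : ℕ → ℤ → ℕ
binomℤ a (+ b)    = a C b
binomℤ a -[1+ _ ] = 0

sumℤ : List ℤ → ℤ
sumℤ = foldr ℤ._+_ (+ 0)

sum1 : ℕ → ℤ
sum1 n = sumℤ (map term (map suc (upTo n)))
  where
  term : ℕ → ℤ
  term k = ((ℤ.- (+ 1)) ℤ.^ (k ℕ.+ 1)) ℤ.* + (((2 ℕ.* k ℕ.∸ 2) C (k ℕ.∸ 1)) ℕ.* ((2 ℕ.* n) C (n ℕ.∸ k)))

sum2 : ℕ → ℕ
sum2 n = sumℕ (map term (upTo (suc n)))
  where
  term : ℕ → ℕ
  term i = (n C i) ℕ.* binomℤ n (+ (2 ℕ.* n ℕ.+ 1) ℤ.- + (3 ℕ.* i))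

-- Let S n = [z^(2n+1)] (1 + z + z³ + z⁴)^n.  Shifting every step by +2 turns the step set into the
-- exponents of 1 + z + z³ + z⁴, so S n counts the bridges of length n: walks from 0 to 1 with no
-- positivity constraint.  The theorem follows from three identities.
--
-- 1. n · numWalks n = S n (module Walks).  By the cycle lemma (module CycleLemma), exactly one of the
--    n cyclic rotations of a bridge stays positive, namely the one starting at the last minimum of
--    its prefix sums.  Since rotation permutes the walks, summing over all walks gives the identity.
-- 2. S n equals the second sum (module SecondSum): expand (1 + z³)^n (1 + z)^n binomially.
-- 3. The first sum equals L n = [z^(n-1)] (1+z)^(2n) (1+4z)^(-1/2) (module FirstSum).  The
--    coefficient sequences of both generating functions satisfy explicit linear relations with
--    polynomial coefficients; explicit polynomial combinations of these relations show that L and S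
--    satisfy the same second-order recurrence (module Recurrence), and L and S agree at n = 0, 1.
module Submission where

module IntegerSums where

  open import Data.Nat as ℕ using (ℕ; zero; suc; s≤s; z≤n)
  import Data.Nat.Properties as ℕP
  open import Data.Integer using (ℤ; +_; 0ℤ; 1ℤ; _+_; _-_)
  open import Data.Integer.Tactic.RingSolver using (solve-∀)
  import Data.Integer.Properties as ℤP
  open import Algebra.Properties.CommutativeSemigroup ℤP.+-commutativeSemigroup using (interchange)
  open import Data.Nat.ListAction renaming (sum to sumℕ)
  open import Data.List using ([]; _∷_; map; applyUpTo)
  open import Relation.Binary.PropositionalEquality
  open import Defs using (sumℤ)

  -- The integer successor of a natural number, in the form the ring solver understands.
  +suc : ∀ j → + suc j ≡ + j + 1ℤ
  +suc j = cong +_ (ℕP.+-comm 1 j)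

  -- down k y = y - 1 - ⋯ - 1 (k times): the iterated predecessor produced by the coefficient
  -- recursions below, where multiplying a generating function by z shifts indices down by one.
  down : ℕ → ℤ → ℤ
  down zero    y = y
  down (suc k) y = down k y - 1ℤ

  down≡ : ∀ k y → down k y ≡ y - + k
  down≡ zero    y = sym (ℤP.+-identityʳ y)
  down≡ (suc k) y = trans (cong (_- 1ℤ) (down≡ k y)) (trans (regroup y (+ k)) (cong (λ t → y - t) (sym (+suc k))))
    where
    regroup : ∀ y K → y - K - 1ℤ ≡ y - (K + 1ℤ)
    regroup = solve-∀

  ΣZ : ℕ → (ℕ → ℤ) → ℤ
  ΣZ n f = sumℤ (applyUpTo f n)

  ΣZ-ext : ∀ n {f g : ℕ → ℤ} → (∀ j → j ℕ.< n → f j ≡ g j) → ΣZ n f ≡ ΣZ n g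
  ΣZ-ext zero    eq = refl
  ΣZ-ext (suc n) eq = cong₂ _+_ (eq 0 (s≤s z≤n)) (ΣZ-ext n (λ j j<n → eq (suc j) (s≤s j<n)))

  ΣZ-+ : ∀ n (f g : ℕ → ℤ) → ΣZ n (λ j → f j + g j) ≡ ΣZ n f + ΣZ n g
  ΣZ-+ zero    f g = refl
  ΣZ-+ (suc n) f g = trans (cong (λ t → f 0 + g 0 + t) (ΣZ-+ n (λ j → f (suc j)) (λ j → g (suc j))))
                           (interchange (f 0) (g 0) _ _)

  ΣZ-last : ∀ n (f : ℕ → ℤ) → ΣZ (suc n) f ≡ ΣZ n f + f n
  ΣZ-last zero    f = ℤP.+-comm (f 0) 0ℤ
  ΣZ-last (suc n) f = trans (cong (λ t → f 0 + t) (ΣZ-last n (λ j → f (suc j))))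
                            (sym (ℤP.+-assoc (f 0) _ (f (suc n))))

  +-sum : ∀ {A : Set} (f : A → ℕ) xs → + sumℕ (map f xs) ≡ sumℤ (map (λ x → + f x) xs)
  +-sum f []       = refl
  +-sum f (x ∷ xs) = trans (ℤP.pos-+ (f x) (sumℕ (map f xs))) (cong (λ t → + f x + t) (+-sum f xs))

module Binomial where

  open import Data.Nat as ℕ using (ℕ; zero; suc)
  import Data.Nat.Properties as ℕP
  open import Data.Nat.Combinatorics using (_C_; nCk+nC[k+1]≡[n+1]C[k+1]; nCk≡nC[n∸k]; nC1≡n; k>n⇒nCk≡0)
  open import Data.Integer using (ℤ; +_; -[1+_]; 1ℤ; _+_; _-_; _*_)
  import Data.Integer.Properties as ℤP
  open import Relation.Binary.PropositionalEquality
  open import Defs using (binomℤ)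
  open IntegerSums

  absorption : ∀ n k → suc k ℕ.* (suc n C suc k) ≡ suc n ℕ.* (n C k)
  absorption zero    zero    = refl
  absorption zero    (suc k) = ℕP.*-zeroʳ (suc (suc k))
  absorption (suc n) zero    =
    trans (ℕP.*-identityˡ _) (trans (nC1≡n (suc (suc n))) (sym (ℕP.*-identityʳ _)))
  absorption (suc n) (suc k) = begin
    suc (suc k) ℕ.* (suc (suc n) C suc (suc k))
      ≡⟨ cong (suc (suc k) ℕ.*_) (sym (nCk+nC[k+1]≡[n+1]C[k+1] (suc n) (suc k))) ⟩
    suc (suc k) ℕ.* (A ℕ.+ B)
      ≡⟨ ℕP.*-distribˡ-+ (suc (suc k)) A B ⟩
    (A ℕ.+ suc k ℕ.* A) ℕ.+ suc (suc k) ℕ.* B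
      ≡⟨ cong₂ ℕ._+_ (cong (A ℕ.+_) (absorption n k)) (absorption n (suc k)) ⟩
    (A ℕ.+ suc n ℕ.* (n C k)) ℕ.+ suc n ℕ.* (n C suc k)
      ≡⟨ ℕP.+-assoc A _ _ ⟩
    A ℕ.+ (suc n ℕ.* (n C k) ℕ.+ suc n ℕ.* (n C suc k))
      ≡⟨ cong (A ℕ.+_) (sym (ℕP.*-distribˡ-+ (suc n) (n C k) (n C suc k))) ⟩
    A ℕ.+ suc n ℕ.* (n C k ℕ.+ n C suc k)
      ≡⟨ cong (λ z → A ℕ.+ suc n ℕ.* z) (nCk+nC[k+1]≡[n+1]C[k+1] n k) ⟩
    suc (suc n) ℕ.* A ∎
    where
    open ≡-Reasoning
    A = suc n C suc k
    B = suc n C suc (suc k)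

  binom-sym : ∀ a b → (a ℕ.+ b) C a ≡ (a ℕ.+ b) C b
  binom-sym a b = trans (nCk≡nC[n∸k] (ℕP.m≤m+n a b)) (cong ((a ℕ.+ b) C_) (ℕP.m+n∸m≡n a b))

  central : ℕ → ℕ
  central j = (j ℕ.+ j) C j

  -- (j+1)·C(2j+2, j+1) = 2(2j+1)·C(2j, j): two absorptions around one symmetry.
  central-rec : ∀ j → suc j ℕ.* central (suc j) ≡ 2 ℕ.* (suc (j ℕ.+ j) ℕ.* central j)
  central-rec j = begin
    suc j ℕ.* ((suc j ℕ.+ suc j) C suc j)
      ≡⟨ cong (λ z → suc j ℕ.* (z C suc j)) j+1+j+1≡ ⟩
    suc j ℕ.* (suc (suc (j ℕ.+ j)) C suc j)
      ≡⟨ absorption (suc (j ℕ.+ j)) j ⟩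
    suc (suc (j ℕ.+ j)) ℕ.* (suc (j ℕ.+ j) C j)
      ≡⟨ cong₂ ℕ._*_ (sym j+1+j+1≡) middle-sym ⟩
    (suc j ℕ.+ suc j) ℕ.* (suc (j ℕ.+ j) C suc j)
      ≡⟨ cong (ℕ._* (suc (j ℕ.+ j) C suc j)) (cong (suc j ℕ.+_) (sym (ℕP.+-identityʳ (suc j)))) ⟩
    (2 ℕ.* suc j) ℕ.* (suc (j ℕ.+ j) C suc j)
      ≡⟨ ℕP.*-assoc 2 (suc j) _ ⟩
    2 ℕ.* (suc j ℕ.* (suc (j ℕ.+ j) C suc j))
      ≡⟨ cong (2 ℕ.*_) (absorption (j ℕ.+ j) j) ⟩
    2 ℕ.* (suc (j ℕ.+ j) ℕ.* central j) ∎
    where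
    open ≡-Reasoning
    j+1+j+1≡ : suc j ℕ.+ suc j ≡ suc (suc (j ℕ.+ j))
    j+1+j+1≡ = cong suc (ℕP.+-suc j j)
    middle-sym : suc (j ℕ.+ j) C j ≡ suc (j ℕ.+ j) C suc j
    middle-sym = subst (λ m → m C j ≡ m C suc j) (ℕP.+-suc j j) (binom-sym j (suc j))

  choose : ℕ → ℤ → ℤ
  choose m x = + binomℤ m x

  choose-pascal : ∀ m x → choose (suc m) x ≡ choose m x + choose m (x - 1ℤ)
  choose-pascal m (+ zero)  = refl
  choose-pascal m (+ suc k) =
    trans (cong +_ (trans (sym (nCk+nC[k+1]≡[n+1]C[k+1] m k)) (ℕP.+-comm (m C k) (m C suc k))))
          (ℤP.pos-+ (m C suc k) (m C k))
  choose-pascal m -[1+ k ]  = refl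

  ΣZ-pascal : ∀ n (X : ℕ → ℤ) →
    ΣZ (suc (suc n)) (λ i → + (suc n C i) * X i)
    ≡ ΣZ (suc n) (λ i → + (n C i) * X i) + ΣZ (suc n) (λ i → + (n C i) * X (suc i))
  ΣZ-pascal n X = begin
    + 1 * X 0 + ΣZ (suc n) (λ i → + (suc n C suc i) * X (suc i))
      ≡⟨ cong (λ t → + 1 * X 0 + t) (trans (ΣZ-ext (suc n) (λ i _ → split i))
                                           (ΣZ-+ (suc n) (λ i → + (n C suc i) * X (suc i)) (λ i → + (n C i) * X (suc i)))) ⟩
    + 1 * X 0 + (ΣZ (suc n) (λ i → + (n C suc i) * X (suc i)) + ΣZ (suc n) (λ i → + (n C i) * X (suc i)))
      ≡⟨ ℤP.+-assoc (+ 1 * X 0) _ _ ⟨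
    (+ 1 * X 0 + ΣZ (suc n) (λ i → + (n C suc i) * X (suc i))) + ΣZ (suc n) (λ i → + (n C i) * X (suc i))
      ≡⟨ cong (λ t → (+ 1 * X 0 + t) + ΣZ (suc n) (λ i → + (n C i) * X (suc i))) drop-last ⟩
    (+ 1 * X 0 + ΣZ n (λ i → + (n C suc i) * X (suc i))) + ΣZ (suc n) (λ i → + (n C i) * X (suc i)) ∎
    where
    open ≡-Reasoning
    split : ∀ i → + (suc n C suc i) * X (suc i) ≡ + (n C suc i) * X (suc i) + + (n C i) * X (suc i)
    split i = trans (cong (_* X (suc i)) (trans (cong +_ pascal) (ℤP.pos-+ (n C suc i) (n C i))))
                    (ℤP.*-distribʳ-+ (X (suc i)) (+ (n C suc i)) (+ (n C i)))
      where
      pascal : suc n C suc i ≡ n C suc i ℕ.+ n C i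
      pascal = trans (sym (nCk+nC[k+1]≡[n+1]C[k+1] n i)) (ℕP.+-comm (n C i) (n C suc i))
    -- The last term carries C(n, n+1) = 0.
    drop-last : ΣZ (suc n) (λ i → + (n C suc i) * X (suc i)) ≡ ΣZ n (λ i → + (n C suc i) * X (suc i))
    drop-last = trans (ΣZ-last n _)
      (trans (cong (λ c → ΣZ n (λ i → + (n C suc i) * X (suc i)) + + c * X (suc n)) (k>n⇒nCk≡0 (ℕP.n<1+n n)))
             (ℤP.+-identityʳ _))

module Recurrence where

  open import Data.Nat as ℕ using (ℕ; zero; suc)
  open import Data.Integer using (ℤ; +_; 0ℤ; 1ℤ; -_; _+_; _*_; ≢-nonZero)
  import Data.Integer.Properties as ℤP
  open import Data.Integer.Tactic.RingSolver using (solve-∀)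
  open import Algebra.Bundles using (AbelianGroup)
  open import Algebra.Properties.Group (AbelianGroup.group ℤP.+-0-abelianGroup) using (∙-cancelˡ)
  open import Data.Product using (_×_; _,_; proj₁; proj₂)
  open import Relation.Binary.PropositionalEquality

  P₀ P₁ P₂ : ℤ → ℤ
  P₀ N = - (+ 18) * (N + 1ℤ) * (+ 2 * N + 1ℤ) * (+ 5 * N + + 11)
  P₁ N = - (+ 35 * N * N * N + + 147 * N * N + + 220 * N + + 120)
  P₂ N = + 2 * (N + 1ℤ) * (+ 5 * N + + 6) * (+ 2 * N + + 5)

  SatisfiesRecurrence : (ℕ → ℤ) → Set
  SatisfiesRecurrence a =
    ∀ n → P₀ (+ n) * a n + P₁ (+ n) * a (suc n) + P₂ (+ n) * a (suc (suc n)) ≡ 0ℤ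

  -- The leading coefficient never vanishes on ℕ: its expansion has positive coefficients.
  P₂-expanded : ∀ N → + 2 * (N + 1ℤ) * (+ 5 * N + + 6) * (+ 2 * N + + 5)
                      ≡ + 60 + N * (+ 134 + N * (+ 94 + N * + 20))
  P₂-expanded = solve-∀

  P₂≢0 : ∀ n → P₂ (+ n) ≢ 0ℤ
  P₂≢0 n P₂≡0 = positive≢0 (trans expanded P₂≡0)
    where
    positive≢0 : ∀ {k} → + suc k ≢ 0ℤ
    positive≢0 ()
    horner : ∀ a x → + (a ℕ.+ n ℕ.* x) ≡ + a + + n * + x
    horner a x = trans (ℤP.pos-+ a (n ℕ.* x)) (cong (λ z → + a + z) (ℤP.pos-* n x))
    expanded : + (60 ℕ.+ n ℕ.* (134 ℕ.+ n ℕ.* (94 ℕ.+ n ℕ.* 20))) ≡ P₂ (+ n)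
    expanded = trans (horner 60 _) (trans (cong (λ z → + 60 + + n * z) (trans (horner 134 _)
                 (cong (λ z → + 134 + + n * z) (horner 94 20)))) (sym (P₂-expanded (+ n))))

  recurrence-unique : ∀ {a b : ℕ → ℤ} → SatisfiesRecurrence a → SatisfiesRecurrence b →
                      a 0 ≡ b 0 → a 1 ≡ b 1 → ∀ n → a n ≡ b n
  recurrence-unique {a} {b} rec-a rec-b a₀≡b₀ a₁≡b₁ n = proj₁ (consecutive n)
    where
    consecutive : ∀ n → a n ≡ b n × a (suc n) ≡ b (suc n)
    consecutive zero    = a₀≡b₀ , a₁≡b₁
    consecutive (suc n) = aₙ₊₁≡bₙ₊₁ , aₙ₊₂≡bₙ₊₂
      where
      aₙ≡bₙ : a n ≡ b n
      aₙ≡bₙ = proj₁ (consecutive n)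
      aₙ₊₁≡bₙ₊₁ : a (suc n) ≡ b (suc n)
      aₙ₊₁≡bₙ₊₁ = proj₂ (consecutive n)
      -- Both recurrences at n share their first two terms, hence also the third.
      leading : P₂ (+ n) * a (suc (suc n)) ≡ P₂ (+ n) * b (suc (suc n))
      leading = ∙-cancelˡ (P₀ (+ n) * a n + P₁ (+ n) * a (suc n)) _ _ (trans (rec-a n) (sym
                  (subst₂ (λ x y → P₀ (+ n) * x + P₁ (+ n) * y + P₂ (+ n) * b (suc (suc n)) ≡ 0ℤ)
                          (sym aₙ≡bₙ) (sym aₙ₊₁≡bₙ₊₁) (rec-b n))))
      aₙ₊₂≡bₙ₊₂ : a (suc (suc n)) ≡ b (suc (suc n))
      aₙ₊₂≡bₙ₊₂ = ℤP.*-cancelˡ-≡ (P₂ (+ n)) _ _ {{≢-nonZero (P₂≢0 n)}} leading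

module FirstSum where

  open import Function using (id)
  open import Data.Nat as ℕ using (ℕ; zero; suc)
  import Data.Nat.Properties as ℕP
  open import Data.Nat.Combinatorics using (_C_)
  open import Data.Integer using (ℤ; +_; -[1+_]; +<+; 0ℤ; 1ℤ; -1ℤ; -_; _+_; _*_; _-_; _^_; _<_)
  import Data.Integer.Properties as ℤP
  open import Data.Integer.Tactic.RingSolver using (solve-∀)
  open import Data.List using (map)
  open import Data.List.Properties using (map-applyUpTo)
  open import Algebra.Properties.CommutativeSemigroup ℕP.+-commutativeSemigroup using (interchange)
  open import Relation.Binary.PropositionalEquality
  open import Defs using (sum1; sumℤ)
  open Binomial
  open IntegerSums
  open Recurrence

  pred< : ∀ h → h - 1ℤ < h
  pred< h = ℤP.i≤pred[j]⇒i<j (ℤP.≤-reflexive (ℤP.+-comm h -1ℤ))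

  extend : (ℕ → ℤ) → ℤ → ℤ
  extend c (+ j)    = c j
  extend c -[1+ _ ] = 0ℤ

  -- b j = (-1)^j C(2j, j), the coefficients of (1+4z)^(-1/2).
  b : ℕ → ℤ
  b j = -1ℤ ^ j * + central j

  b-rel : ∀ x → x * extend b x + (+ 4 * x - + 2) * extend b (down 1 x) ≡ 0ℤ
  b-rel (+ zero)  = refl
  b-rel (+ suc j) = step (+ j) (+ suc j) (-1ℤ ^ j) (+ central j) (+ central (suc j)) (+suc j) central-recℤ
    where
    central-recℤ : + suc j * + central (suc j) ≡ + 2 * ((+ j + + j + 1ℤ) * + central j)
    central-recℤ = begin
      + suc j * + central (suc j)                 ≡⟨ ℤP.pos-* (suc j) (central (suc j)) ⟨
      + (suc j ℕ.* central (suc j))               ≡⟨ cong +_ (central-rec j) ⟩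
      + (2 ℕ.* (suc (j ℕ.+ j) ℕ.* central j))     ≡⟨ ℤP.pos-* 2 (suc (j ℕ.+ j) ℕ.* central j) ⟩
      + 2 * + (suc (j ℕ.+ j) ℕ.* central j)       ≡⟨ cong (+ 2 *_) (ℤP.pos-* (suc (j ℕ.+ j)) (central j)) ⟩
      + 2 * (+ suc (j ℕ.+ j) * + central j)       ≡⟨ cong (λ t → + 2 * (t * + central j)) (+suc (j ℕ.+ j)) ⟩
      + 2 * ((+ j + + j + 1ℤ) * + central j)      ∎
      where open ≡-Reasoning
    step : ∀ J X σ c c′ → X ≡ J + 1ℤ → X * c′ ≡ + 2 * ((J + J + 1ℤ) * c) →
           X * (-1ℤ * σ * c′) + (+ 4 * X - + 2) * (σ * c) ≡ 0ℤ
    step J X σ c c′ refl rec = begin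
      X * (-1ℤ * σ * c′) + (+ 4 * X - + 2) * (σ * c)    ≡⟨ regroup J σ c c′ ⟩
      - σ * (X * c′) + σ * (+ 2 * ((J + J + 1ℤ) * c))   ≡⟨ cong (λ t → - σ * t + σ * (+ 2 * ((J + J + 1ℤ) * c))) rec ⟩
      - σ * t + σ * t                                   ≡⟨ cancel σ t ⟩
      0ℤ                                                ∎
      where
      open ≡-Reasoning
      t = + 2 * ((J + J + 1ℤ) * c)
      regroup : ∀ J σ c c′ → (J + 1ℤ) * (-1ℤ * σ * c′) + (+ 4 * (J + 1ℤ) - + 2) * (σ * c)
                             ≡ - σ * ((J + 1ℤ) * c′) + σ * (+ 2 * ((J + J + 1ℤ) * c))
      regroup = solve-∀
      cancel : ∀ σ t → - σ * t + σ * t ≡ 0ℤ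
      cancel = solve-∀
  b-rel -[1+ k ]  = cong₂ _+_ (ℤP.*-zeroʳ -[1+ k ]) (ℤP.*-zeroʳ (+ 4 * -[1+ k ] - + 2))

  times1+z : (ℤ → ℤ) → ℤ → ℤ
  times1+z f x = f x + f (down 1 x)

  -- U m x = [z^x] (1+z)^m (1+4z)^(-1/2).
  U : ℕ → ℤ → ℤ
  U zero    = extend b
  U (suc m) = times1+z (U m)

  UAnnihilated : ℕ → (ℤ → ℤ) → Set
  UAnnihilated m f = ∀ x →
    x * f x + (+ 5 * x - + 3 - + m) * f (down 1 x) + (+ 4 * x - + 4 * + m - + 6) * f (down 2 x) ≡ 0ℤ

  -- The relation for m = 0 is the sum of two consecutive instances of b-rel.
  U₀-annihilated : UAnnihilated 0 (extend b)
  U₀-annihilated x = trans (regroup x (extend b x) (extend b (down 1 x)) (extend b (down 2 x)))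
                           (cong₂ _+_ (b-rel x) (b-rel (down 1 x)))
    where
    regroup : ∀ x u₀ u₁ u₂ → x * u₀ + (+ 5 * x - + 3 - + 0) * u₁ + (+ 4 * x - + 4 * + 0 - + 6) * u₂
                        ≡ (x * u₀ + (+ 4 * x - + 2) * u₁) + ((x - 1ℤ) * u₁ + (+ 4 * (x - 1ℤ) - + 2) * u₂)
    regroup = solve-∀

  -- Multiplying by (1+z) raises m by one: the new relation at x is the sum of the old ones at x and x-1.
  times1+z-annihilated : ∀ m f → UAnnihilated m f → UAnnihilated (suc m) (times1+z f)
  times1+z-annihilated m f ann x =
    combine (+ m) (+ suc m) (f x) (f (down 1 x)) (f (down 2 x)) (f (down 3 x)) (+suc m) (ann x) (ann (down 1 x))
    where
    combine : ∀ M M′ u₀ u₁ u₂ u₃ → M′ ≡ M + 1ℤ →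
      x * u₀ + (+ 5 * x - + 3 - M) * u₁ + (+ 4 * x - + 4 * M - + 6) * u₂ ≡ 0ℤ →
      (x - 1ℤ) * u₁ + (+ 5 * (x - 1ℤ) - + 3 - M) * u₂ + (+ 4 * (x - 1ℤ) - + 4 * M - + 6) * u₃ ≡ 0ℤ →
      x * (u₀ + u₁) + (+ 5 * x - + 3 - M′) * (u₁ + u₂) + (+ 4 * x - + 4 * M′ - + 6) * (u₂ + u₃) ≡ 0ℤ
    combine M M′ u₀ u₁ u₂ u₃ refl e₁ e₂ = trans (regroup x M u₀ u₁ u₂ u₃) (cong₂ _+_ e₁ e₂)
      where
      regroup : ∀ x M u₀ u₁ u₂ u₃ →
        x * (u₀ + u₁) + (+ 5 * x - + 3 - (M + 1ℤ)) * (u₁ + u₂) + (+ 4 * x - + 4 * (M + 1ℤ) - + 6) * (u₂ + u₃)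
        ≡ (x * u₀ + (+ 5 * x - + 3 - M) * u₁ + (+ 4 * x - + 4 * M - + 6) * u₂)
          + ((x - 1ℤ) * u₁ + (+ 5 * (x - 1ℤ) - + 3 - M) * u₂ + (+ 4 * (x - 1ℤ) - + 4 * M - + 6) * u₃)
      regroup = solve-∀

  U-annihilated : ∀ m → UAnnihilated m (U m)
  U-annihilated zero    = U₀-annihilated
  U-annihilated (suc m) = times1+z-annihilated m (U m) (U-annihilated m)

  -- L n = [z^(n-1)] (1+z)^(2n) (1+4z)^(-1/2); it will be identified with the first sum.
  L : ℕ → ℤ
  L n = U (n ℕ.+ n) (down 1 (+ n))

  -- L satisfies the recurrence: with k = 2n and x = n+1, the three values L n, L (n+1), L (n+2) are
  -- combinations of U k x, ..., U k (x-4), and an explicit polynomial combination of the relations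
  -- of U k at x, x-1, x-2 yields the recurrence.
  L-recurrence : SatisfiesRecurrence L
  L-recurrence n = begin
    P₀ N * L n + P₁ N * L (suc n) + P₂ N * L (suc (suc n))
      ≡⟨ cong₂ (λ s t → P₀ N * L n + P₁ N * U s (+ n) + P₂ N * U t x) (+-twice 1) (+-twice 2) ⟩
    P₀ N * U k (down 2 x) + P₁ N * U (2 ℕ.+ k) (down 1 x) + P₂ N * U (4 ℕ.+ k) x
      ≡⟨ certificate N x (U k x) (U k (down 1 x)) (U k (down 2 x)) (U k (down 3 x)) (U k (down 4 x)) (+suc n)
                     (U-annihilated k x) (U-annihilated k (down 1 x)) (U-annihilated k (down 2 x)) ⟩
    0ℤ ∎
    where
    open ≡-Reasoning
    N x : ℤ
    N = + n
    x = + suc n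
    k : ℕ
    k = n ℕ.+ n
    +-twice : ∀ i → (i ℕ.+ n) ℕ.+ (i ℕ.+ n) ≡ (i ℕ.+ i) ℕ.+ k
    +-twice i = interchange i n i n
    certificate : ∀ N X v₀ v₁ v₂ v₃ v₄ → X ≡ N + 1ℤ →
      X * v₀ + (+ 5 * X - + 3 - (N + N)) * v₁ + (+ 4 * X - + 4 * (N + N) - + 6) * v₂ ≡ 0ℤ →
      (X - 1ℤ) * v₁ + (+ 5 * (X - 1ℤ) - + 3 - (N + N)) * v₂ + (+ 4 * (X - 1ℤ) - + 4 * (N + N) - + 6) * v₃ ≡ 0ℤ →
      (X - 1ℤ - 1ℤ) * v₂ + (+ 5 * (X - 1ℤ - 1ℤ) - + 3 - (N + N)) * v₃
        + (+ 4 * (X - 1ℤ - 1ℤ) - + 4 * (N + N) - + 6) * v₄ ≡ 0ℤ →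
      P₀ N * v₂ + P₁ N * ((v₁ + v₂) + (v₂ + v₃))
        + P₂ N * ((((v₀ + v₁) + (v₁ + v₂)) + ((v₁ + v₂) + (v₂ + v₃)))
                 + (((v₁ + v₂) + (v₂ + v₃)) + ((v₂ + v₃) + (v₃ + v₄)))) ≡ 0ℤ
    certificate N X v₀ v₁ v₂ v₃ v₄ refl e₀ e₁ e₂ = trans (identity N v₀ v₁ v₂ v₃ v₄)
      (trans (cong₂ _+_ (cong₂ _+_ (cong (Q₀ *_) e₀) (cong (Q₁ *_) e₁)) (cong (Q₂ *_) e₂))
             (zeros Q₀ Q₁ Q₂))
      where
      Q₀ Q₁ Q₂ : ℤ
      Q₀ = + 20 * N * N + + 74 * N + + 60
      Q₁ = - (+ 15 * N * N + + 33 * N + + 12)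
      Q₂ = - (+ 5 * N * N + + 11 * N + + 6)
      zeros : ∀ a b c → a * 0ℤ + b * 0ℤ + c * 0ℤ ≡ 0ℤ
      zeros = solve-∀
      identity : ∀ N v₀ v₁ v₂ v₃ v₄ →
        (- (+ 18) * (N + 1ℤ) * (+ 2 * N + 1ℤ) * (+ 5 * N + + 11)) * v₂
          + (- (+ 35 * N * N * N + + 147 * N * N + + 220 * N + + 120)) * ((v₁ + v₂) + (v₂ + v₃))
          + (+ 2 * (N + 1ℤ) * (+ 5 * N + + 6) * (+ 2 * N + + 5))
            * ((((v₀ + v₁) + (v₁ + v₂)) + ((v₁ + v₂) + (v₂ + v₃)))
               + (((v₁ + v₂) + (v₂ + v₃)) + ((v₂ + v₃) + (v₃ + v₄))))
        ≡ (+ 20 * N * N + + 74 * N + + 60)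
            * ((N + 1ℤ) * v₀ + (+ 5 * (N + 1ℤ) - + 3 - (N + N)) * v₁ + (+ 4 * (N + 1ℤ) - + 4 * (N + N) - + 6) * v₂)
          + (- (+ 15 * N * N + + 33 * N + + 12))
            * ((N + 1ℤ - 1ℤ) * v₁ + (+ 5 * (N + 1ℤ - 1ℤ) - + 3 - (N + N)) * v₂
               + (+ 4 * (N + 1ℤ - 1ℤ) - + 4 * (N + N) - + 6) * v₃)
          + (- (+ 5 * N * N + + 11 * N + + 6))
            * ((N + 1ℤ - 1ℤ - 1ℤ) * v₂ + (+ 5 * (N + 1ℤ - 1ℤ - 1ℤ) - + 3 - (N + N)) * v₃
               + (+ 4 * (N + 1ℤ - 1ℤ - 1ℤ) - + 4 * (N + N) - + 6) * v₄)
      identity = solve-∀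

  ΣZ-unit : ∀ n (c : ℕ → ℤ) h → h < + n → ΣZ n (λ j → c j * choose 0 (h - + j)) ≡ extend c h
  ΣZ-unit zero    c (+ k)    (+<+ ())
  ΣZ-unit zero    c -[1+ k ] _ = refl
  ΣZ-unit (suc n) c h h<n+1 = begin
    c 0 * choose 0 (h - + 0) + ΣZ n (λ j → c (suc j) * choose 0 (h - + suc j))
      ≡⟨ cong (λ t → c 0 * choose 0 (h - + 0) + t)
              (ΣZ-ext n (λ j _ → cong (λ y → c (suc j) * choose 0 y) (h-[j+1]≡h-1-j h j))) ⟩
    c 0 * choose 0 (h - + 0) + ΣZ n (λ j → c (suc j) * choose 0 (h - 1ℤ - + j))
      ≡⟨ cong (λ t → c 0 * choose 0 (h - + 0) + t)
              (ΣZ-unit n (λ j → c (suc j)) (h - 1ℤ) (ℤP.+-monoˡ-< -1ℤ h<n+1)) ⟩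
    c 0 * choose 0 (h - + 0) + extend (λ j → c (suc j)) (h - 1ℤ)
      ≡⟨ head+tail h ⟩
    extend c h ∎
    where
    open ≡-Reasoning
    h-[j+1]≡h-1-j : ∀ h j → h - + suc j ≡ h - 1ℤ - + j
    h-[j+1]≡h-1-j h j = trans (cong (λ t → h - t) (+suc j)) (regroup h (+ j))
      where
      regroup : ∀ h J → h - (J + 1ℤ) ≡ h - 1ℤ - J
      regroup = solve-∀
    -- The j = 0 term is c 0 exactly at h = 0; the shifted tail supplies c at positive h.
    head+tail : ∀ h → c 0 * choose 0 (h - + 0) + extend (λ j → c (suc j)) (h - 1ℤ) ≡ extend c h
    head+tail (+ zero)  = trans (ℤP.+-identityʳ _) (ℤP.*-identityʳ (c 0))
    head+tail (+ suc k) = trans (cong (_+ c (suc k)) (ℤP.*-zeroʳ (c 0))) (ℤP.+-identityˡ _)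
    head+tail -[1+ k ]  = trans (ℤP.+-identityʳ _) (ℤP.*-zeroʳ (c 0))

  -- Closed form U m h = Σ_{j<n} b_j C(m, h-j) for any n > h: expanding (1+z)^m by Pascal's rule.
  U-closed : ∀ m n h → h < + n → U m h ≡ ΣZ n (λ j → b j * choose m (h - + j))
  U-closed zero    n h h<n = sym (ΣZ-unit n b h h<n)
  U-closed (suc m) n h h<n = begin
    U m h + U m (h - 1ℤ)
      ≡⟨ cong₂ _+_ (U-closed m n h h<n) (U-closed m n (h - 1ℤ) (ℤP.<-trans (pred< h) h<n)) ⟩
    ΣZ n (λ j → b j * choose m (h - + j)) + ΣZ n (λ j → b j * choose m (h - 1ℤ - + j))
      ≡⟨ ΣZ-+ n _ _ ⟨
    ΣZ n (λ j → b j * choose m (h - + j) + b j * choose m (h - 1ℤ - + j))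
      ≡⟨ ΣZ-ext n (λ j _ → pascal-term j) ⟩
    ΣZ n (λ j → b j * choose (suc m) (h - + j)) ∎
    where
    open ≡-Reasoning
    swap-1 : ∀ h J → h - 1ℤ - J ≡ h - J - 1ℤ
    swap-1 = solve-∀
    pascal-term : ∀ j → b j * choose m (h - + j) + b j * choose m (h - 1ℤ - + j)
                        ≡ b j * choose (suc m) (h - + j)
    pascal-term j = trans (sym (ℤP.*-distribˡ-+ (b j) _ _))
      (cong (b j *_) (trans (cong (λ y → choose m (h - + j) + choose m y) (swap-1 h (+ j)))
                            (sym (choose-pascal m (h - + j)))))

  -- The first sum of the theorem is L n: its k-th term is b_(k-1) C(2n, n-k).
  sum1≡L : ∀ n → sum1 n ≡ L n
  sum1≡L n = begin
    sum1 n
      ≡⟨ cong sumℤ (trans (cong (map term) (map-applyUpTo id suc n)) (map-applyUpTo suc term n)) ⟩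
    ΣZ n (λ j → term (suc j))
      ≡⟨ ΣZ-ext n shifted-term ⟩
    ΣZ n (λ j → b j * choose (n ℕ.+ n) (+ n - 1ℤ - + j))
      ≡⟨ U-closed (n ℕ.+ n) n (+ n - 1ℤ) (pred< (+ n)) ⟨
    L n ∎
    where
    open ≡-Reasoning
    term : ℕ → ℤ
    term k = ((- (+ 1)) ^ (k ℕ.+ 1)) * + (((2 ℕ.* k ℕ.∸ 2) C (k ℕ.∸ 1)) ℕ.* ((2 ℕ.* n) C (n ℕ.∸ k)))
    sign : ∀ j → -1ℤ ^ (suc j ℕ.+ 1) ≡ -1ℤ ^ j
    sign j = trans (cong (-1ℤ ^_) (ℕP.+-comm (suc j) 1)) (double-negation (-1ℤ ^ j))
      where
      double-negation : ∀ σ → -1ℤ * (-1ℤ * σ) ≡ σ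
      double-negation = solve-∀
    central-index : ∀ j → 2 ℕ.* suc j ℕ.∸ 2 ≡ j ℕ.+ j
    central-index j = trans (cong (ℕ._∸ 2) (ℕP.*-suc 2 j)) (cong (j ℕ.+_) (ℕP.+-identityʳ j))
    lower-index : ∀ j → j ℕ.< n → + n - 1ℤ - + j ≡ + (n ℕ.∸ suc j)
    lower-index j j<n = trans (cong (λ t → + t - 1ℤ - + j) (sym (ℕP.m+[n∸m]≡n j<n)))
                              (trans (cong (λ t → t - 1ℤ - + j) split) (cancel (+ j) (+ (n ℕ.∸ suc j))))
      where
      split : + (suc j ℕ.+ (n ℕ.∸ suc j)) ≡ + j + 1ℤ + + (n ℕ.∸ suc j)
      split = trans (ℤP.pos-+ (suc j) (n ℕ.∸ suc j)) (cong (_+ + (n ℕ.∸ suc j)) (+suc j))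
      cancel : ∀ J D → J + 1ℤ + D - 1ℤ - J ≡ D
      cancel = solve-∀
    shifted-term : ∀ j → j ℕ.< n → term (suc j) ≡ b j * choose (n ℕ.+ n) (+ n - 1ℤ - + j)
    shifted-term j j<n = begin
      -1ℤ ^ (suc j ℕ.+ 1) * + (((2 ℕ.* suc j ℕ.∸ 2) C j) ℕ.* ((2 ℕ.* n) C (n ℕ.∸ suc j)))
        ≡⟨ cong₂ (λ s t → s * + ((t C j) ℕ.* ((2 ℕ.* n) C (n ℕ.∸ suc j)))) (sign j) (central-index j) ⟩
      -1ℤ ^ j * + (central j ℕ.* ((2 ℕ.* n) C (n ℕ.∸ suc j)))
        ≡⟨ cong (λ t → -1ℤ ^ j * + (central j ℕ.* (t C (n ℕ.∸ suc j)))) (cong (n ℕ.+_) (ℕP.+-identityʳ n)) ⟩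
      -1ℤ ^ j * + (central j ℕ.* ((n ℕ.+ n) C (n ℕ.∸ suc j)))
        ≡⟨ cong (-1ℤ ^ j *_) (ℤP.pos-* (central j) _) ⟩
      -1ℤ ^ j * (+ central j * choose (n ℕ.+ n) (+ (n ℕ.∸ suc j)))
        ≡⟨ ℤP.*-assoc (-1ℤ ^ j) _ _ ⟨
      b j * choose (n ℕ.+ n) (+ (n ℕ.∸ suc j))
        ≡⟨ cong (λ y → b j * choose (n ℕ.+ n) y) (lower-index j j<n) ⟨
      b j * choose (n ℕ.+ n) (+ n - 1ℤ - + j) ∎

module SecondSum where

  open import Function using (id)
  open import Data.Nat as ℕ using (ℕ; zero; suc)
  import Data.Nat.Properties as ℕP
  open import Data.Nat.Combinatorics using (_C_)
  open import Data.Integer using (ℤ; +_; -[1+_]; 0ℤ; 1ℤ; -_; _+_; _*_; _-_)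
  import Data.Integer.Properties as ℤP
  open import Data.Integer.Tactic.RingSolver using (solve-∀)
  open import Data.List using (map; upTo)
  open import Data.List.Properties using (map-applyUpTo)
  open import Relation.Binary.PropositionalEquality
  open import Defs using (sum1; sum2; sumℤ; binomℤ)
  open IntegerSums
  open Binomial
  open Recurrence
  open FirstSum using (L; L-recurrence; sum1≡L)

  -- Multiplication of a generating function by 1 + z + z³ + z⁴ = z²(z⁻² + z⁻¹ + z + z²),
  -- i.e. by the step polynomial of the walks shifted by z².
  times-steps : (ℤ → ℤ) → ℤ → ℤ
  times-steps f x = f x + f (down 1 x) + f (down 3 x) + f (down 4 x)

  -- G n x = [z^x] (1 + z + z³ + z⁴)^n.
  G : ℕ → ℤ → ℤ
  G zero    = choose 0
  G (suc n) = times-steps (G n)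

  GRelation : ℤ → ℤ → ℤ → ℤ → ℤ → ℤ → Set
  GRelation N y a₀ a₁ a₂ a₃ = y * a₀ - N * a₁ + N * a₂ + (y - + 3 - + 4 * N) * a₃ ≡ 0ℤ

  GAnnihilated : ℕ → (ℤ → ℤ) → Set
  GAnnihilated n f = ∀ y → GRelation (+ n) y (f y) (f (down 1 y)) (f (down 2 y)) (f (down 3 y))

  x·unit≡0 : ∀ x → x * choose 0 x ≡ 0ℤ
  x·unit≡0 (+ zero)  = refl
  x·unit≡0 (+ suc k) = ℤP.*-zeroʳ (+ suc k)
  x·unit≡0 -[1+ k ]  = ℤP.*-zeroʳ -[1+ k ]

  G₀-annihilated : GAnnihilated 0 (G 0)
  G₀-annihilated y = trans (regroup y (g y) (g (down 1 y)) (g (down 2 y)) (g (down 3 y)))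
                           (cong₂ _+_ (x·unit≡0 y) (x·unit≡0 (down 3 y)))
    where
    g : ℤ → ℤ
    g = choose 0
    regroup : ∀ y a₀ a₁ a₂ a₃ → y * a₀ - + 0 * a₁ + + 0 * a₂ + (y - + 3 - + 4 * + 0) * a₃
                              ≡ y * a₀ + (y - 1ℤ - 1ℤ - 1ℤ) * a₃
    regroup = solve-∀

  -- Multiplying by 1 + z + z³ + z⁴ raises n by one: the new relation at y is the sum of the
  -- old ones at y, y-1, y-3 and y-4.
  times-steps-annihilated : ∀ n f → GAnnihilated n f → GAnnihilated (suc n) (times-steps f)
  times-steps-annihilated n f ann y =
    combine (+ n) (+ suc n) (+suc n) (ann y) (ann (down 1 y)) (ann (down 3 y)) (ann (down 4 y))
    where
    h : ℕ → ℤ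
    h i = f (down i y)
    combine : ∀ N N′ → N′ ≡ N + 1ℤ →
      GRelation N y (h 0) (h 1) (h 2) (h 3) → GRelation N (down 1 y) (h 1) (h 2) (h 3) (h 4) →
      GRelation N (down 3 y) (h 3) (h 4) (h 5) (h 6) → GRelation N (down 4 y) (h 4) (h 5) (h 6) (h 7) →
      GRelation N′ y (h 0 + h 1 + h 3 + h 4) (h 1 + h 2 + h 4 + h 5) (h 2 + h 3 + h 5 + h 6) (h 3 + h 4 + h 6 + h 7)
    combine N N′ refl e₀ e₁ e₃ e₄ =
      trans (regroup y N (h 0) (h 1) (h 2) (h 3) (h 4) (h 5) (h 6) (h 7)) (cong₂ _+_ (cong₂ _+_ (cong₂ _+_ e₀ e₁) e₃) e₄)
      where
      regroup : ∀ y N h0 h1 h2 h3 h4 h5 h6 h7 →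
        y * (h0 + h1 + h3 + h4) - (N + 1ℤ) * (h1 + h2 + h4 + h5) + (N + 1ℤ) * (h2 + h3 + h5 + h6)
          + (y - + 3 - + 4 * (N + 1ℤ)) * (h3 + h4 + h6 + h7)
        ≡ (y * h0 - N * h1 + N * h2 + (y - + 3 - + 4 * N) * h3)
          + ((y - 1ℤ) * h1 - N * h2 + N * h3 + (y - 1ℤ - + 3 - + 4 * N) * h4)
          + ((y - 1ℤ - 1ℤ - 1ℤ) * h3 - N * h4 + N * h5 + (y - 1ℤ - 1ℤ - 1ℤ - + 3 - + 4 * N) * h6)
          + ((y - 1ℤ - 1ℤ - 1ℤ - 1ℤ) * h4 - N * h5 + N * h6 + (y - 1ℤ - 1ℤ - 1ℤ - 1ℤ - + 3 - + 4 * N) * h7)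
      regroup = solve-∀

  G-annihilated : ∀ n → GAnnihilated n (G n)
  G-annihilated zero    = G₀-annihilated
  G-annihilated (suc n) = times-steps-annihilated n (G n) (G-annihilated n)

  -- The step polynomial is palindromic, hence G n x = G n (4n - x).
  G-symmetric : ∀ n x → G n x ≡ G n (+ 4 * + n - x)
  G-symmetric zero    (+ zero)  = refl
  G-symmetric zero    (+ suc k) = refl
  G-symmetric zero    -[1+ k ]  = refl
  G-symmetric (suc n) x = begin
    g x + g (down 1 x) + g (down 3 x) + g (down 4 x)
      ≡⟨ cong₂ _+_ (cong₂ _+_ (cong₂ _+_ (mirror 4 0 refl) (mirror 3 1 refl)) (mirror 1 3 refl)) (mirror 0 4 refl) ⟩
    g (down 4 x′) + g (down 3 x′) + g (down 1 x′) + g x′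
      ≡⟨ reverse (g (down 4 x′)) (g (down 3 x′)) (g (down 1 x′)) (g x′) ⟩
    g x′ + g (down 1 x′) + g (down 3 x′) + g (down 4 x′)
      ≡⟨ cong (G (suc n)) (cong (_- x) (cong (+ 4 *_) (sym (+suc n)))) ⟩
    G (suc n) (+ 4 * + suc n - x) ∎
    where
    open ≡-Reasoning
    g : ℤ → ℤ
    g = G n
    x′ : ℤ
    x′ = + 4 * (+ n + 1ℤ) - x
    mirror : ∀ i j → i ℕ.+ j ≡ 4 → g (down j x) ≡ g (down i x′)
    mirror i j i+j≡4 = trans (G-symmetric n (down j x)) (cong g (begin
      + 4 * + n - down j x          ≡⟨ cong (λ t → + 4 * + n - t) (down≡ j x) ⟩
      + 4 * + n - (x - + j)         ≡⟨ reflect (+ n) x (+ i) (+ j) (cong +_ i+j≡4) ⟩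
      + 4 * (+ n + 1ℤ) - x - + i    ≡⟨ down≡ i x′ ⟨
      down i x′                     ∎))
      where
      reflect : ∀ N x I J → I + J ≡ + 4 → + 4 * N - (x - J) ≡ + 4 * (N + 1ℤ) - x - I
      reflect N x I J I+J≡4 =
        trans (shift N x I J) (trans (cong (λ t → + 4 * (N + 1ℤ) - x - I + (t - + 4)) I+J≡4) (ℤP.+-identityʳ _))
        where
        shift : ∀ N x I J → + 4 * N - (x - J) ≡ + 4 * (N + 1ℤ) - x - I + (I + J - + 4)
        shift = solve-∀
    reverse : ∀ a b c d → a + b + c + d ≡ d + c + b + a
    reverse = solve-∀

  -- S n = [z^(2n+1)] (1 + z + z³ + z⁴)^n, the number of walks from 0 to 1 (up to the shift by z^(2n)).
  S : ℕ → ℤ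
  S n = G n (+ 2 * + n + 1ℤ)

  -- S satisfies the recurrence: with y = 2n+5, the values S n, S (n+1), S (n+2) are combinations of
  -- G n y, ..., G n (y-8); the symmetry of G folds G n (y-10+i) onto G n (y-i), and an explicit
  -- polynomial combination of the relations of G n at y-4, ..., y-7 yields the recurrence.
  S-recurrence : SatisfiesRecurrence S
  S-recurrence n = begin
    P₀ N * S n + P₁ N * S (suc n) + P₂ N * S (suc (suc n))
      ≡⟨ cong₂ _+_ (cong₂ _+_ (cong (λ t → P₀ N * G n t) index₀) (cong (λ t → P₁ N * G (suc n) t) index₁))
                   (cong (λ t → P₂ N * G (suc (suc n)) t) index₂) ⟩
    P₀ N * g 4 + P₁ N * G (suc n) (down 2 y) + P₂ N * G (suc (suc n)) y
      ≡⟨ certificate (g 0) (g 1) (g 2) (g 3) (g 4) (g 5) (g 6) (g 7) (g 8) (g 9) (g 10)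
                     (mirror 0 10 refl) (mirror 1 9 refl) (mirror 2 8 refl) (mirror 3 7 refl) (mirror 4 6 refl)
                     (G-annihilated n (down 4 y)) (G-annihilated n (down 5 y))
                     (G-annihilated n (down 6 y)) (G-annihilated n (down 7 y)) ⟩
    0ℤ ∎
    where
    open ≡-Reasoning
    N y : ℤ
    N = + n
    y = + 2 * N + + 5
    g : ℕ → ℤ
    g i = G n (down i y)
    index₀ : + 2 * N + 1ℤ ≡ down 4 y
    index₀ = trans (regroup N) (sym (down≡ 4 y))
      where
      regroup : ∀ N → + 2 * N + 1ℤ ≡ + 2 * N + + 5 - + 4
      regroup = solve-∀
    index₁ : + 2 * + suc n + 1ℤ ≡ down 2 y
    index₁ = trans (cong (λ t → + 2 * t + 1ℤ) (+suc n)) (trans (regroup N) (sym (down≡ 2 y)))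
      where
      regroup : ∀ N → + 2 * (N + 1ℤ) + 1ℤ ≡ + 2 * N + + 5 - + 2
      regroup = solve-∀
    index₂ : + 2 * + suc (suc n) + 1ℤ ≡ y
    index₂ = trans (cong (λ t → + 2 * t + 1ℤ) (trans (+suc (suc n)) (cong (_+ 1ℤ) (+suc n)))) (regroup N)
      where
      regroup : ∀ N → + 2 * (N + 1ℤ + 1ℤ) + 1ℤ ≡ + 2 * N + + 5
      regroup = solve-∀
    mirror : ∀ i j → i ℕ.+ j ≡ 10 → g j ≡ g i
    mirror i j i+j≡10 = trans (G-symmetric n (down j y)) (cong (G n) (begin
      + 4 * N - down j y    ≡⟨ cong (λ t → + 4 * N - t) (down≡ j y) ⟩
      + 4 * N - (y - + j)   ≡⟨ trans (shift N (+ i) (+ j)) (trans (cong (λ t → y - + i + (t - + 10)) (cong +_ i+j≡10))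
                                                                  (ℤP.+-identityʳ _)) ⟩
      y - + i               ≡⟨ down≡ i y ⟨
      down i y              ∎))
      where
      shift : ∀ N I J → + 4 * N - (+ 2 * N + + 5 - J) ≡ + 2 * N + + 5 - I + (I + J - + 10)
      shift = solve-∀
    certificate : ∀ g₀ g₁ g₂ g₃ g₄ g₅ g₆ g₇ g₈ g₉ g₁₀ →
      g₁₀ ≡ g₀ → g₉ ≡ g₁ → g₈ ≡ g₂ → g₇ ≡ g₃ → g₆ ≡ g₄ →
      GRelation N (down 4 y) g₄ g₅ g₆ g₇ → GRelation N (down 5 y) g₅ g₆ g₇ g₈ →
      GRelation N (down 6 y) g₆ g₇ g₈ g₉ → GRelation N (down 7 y) g₇ g₈ g₉ g₁₀ →
      P₀ N * g₄ + P₁ N * (g₂ + g₃ + g₅ + g₆)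
        + P₂ N * ((g₀ + g₁ + g₃ + g₄) + (g₁ + g₂ + g₄ + g₅) + (g₃ + g₄ + g₆ + g₇) + (g₄ + g₅ + g₇ + g₈)) ≡ 0ℤ
    certificate g₀ g₁ g₂ g₃ g₄ g₅ _ _ _ _ _ refl refl refl refl refl e₄ e₅ e₆ e₇ =
      trans (identity N g₀ g₁ g₂ g₃ g₄ g₅)
            (trans (cong₂ _+_ (cong₂ _+_ (cong₂ _+_ (cong (Q₄ *_) e₄) (cong (Q₅ *_) e₅)) (cong (Q₆ *_) e₆))
                              (cong (Q₇ *_) e₇))
                   (zeros Q₄ Q₅ Q₆ Q₇))
      where
      Q₄ Q₅ Q₆ Q₇ : ℤ
      Q₄ = - (+ 48 + + 85 * N + + 25 * N * N)
      Q₅ = - (+ 22 * N + + 10 * N * N)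
      Q₆ = - (+ 30 + + 55 * N + + 25 * N * N)
      Q₇ = - (+ 12 + + 22 * N + + 10 * N * N)
      zeros : ∀ a b c d → a * 0ℤ + b * 0ℤ + c * 0ℤ + d * 0ℤ ≡ 0ℤ
      zeros = solve-∀
      identity : ∀ N g0 g1 g2 g3 g4 g5 →
        (- (+ 18) * (N + 1ℤ) * (+ 2 * N + 1ℤ) * (+ 5 * N + + 11)) * g4
          + (- (+ 35 * N * N * N + + 147 * N * N + + 220 * N + + 120)) * (g2 + g3 + g5 + g4)
          + (+ 2 * (N + 1ℤ) * (+ 5 * N + + 6) * (+ 2 * N + + 5))
            * ((g0 + g1 + g3 + g4) + (g1 + g2 + g4 + g5) + (g3 + g4 + g4 + g3) + (g4 + g5 + g3 + g2))
        ≡ (- (+ 48 + + 85 * N + + 25 * N * N))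
            * (((+ 2 * N + + 5) - 1ℤ - 1ℤ - 1ℤ - 1ℤ) * g4 - N * g5 + N * g4
               + (((+ 2 * N + + 5) - 1ℤ - 1ℤ - 1ℤ - 1ℤ) - + 3 - + 4 * N) * g3)
          + (- (+ 22 * N + + 10 * N * N))
            * (((+ 2 * N + + 5) - 1ℤ - 1ℤ - 1ℤ - 1ℤ - 1ℤ) * g5 - N * g4 + N * g3
               + (((+ 2 * N + + 5) - 1ℤ - 1ℤ - 1ℤ - 1ℤ - 1ℤ) - + 3 - + 4 * N) * g2)
          + (- (+ 30 + + 55 * N + + 25 * N * N))
            * (((+ 2 * N + + 5) - 1ℤ - 1ℤ - 1ℤ - 1ℤ - 1ℤ - 1ℤ) * g4 - N * g3 + N * g2
               + (((+ 2 * N + + 5) - 1ℤ - 1ℤ - 1ℤ - 1ℤ - 1ℤ - 1ℤ) - + 3 - + 4 * N) * g1)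
          + (- (+ 12 + + 22 * N + + 10 * N * N))
            * (((+ 2 * N + + 5) - 1ℤ - 1ℤ - 1ℤ - 1ℤ - 1ℤ - 1ℤ - 1ℤ) * g3 - N * g2 + N * g1
               + (((+ 2 * N + + 5) - 1ℤ - 1ℤ - 1ℤ - 1ℤ - 1ℤ - 1ℤ - 1ℤ) - + 3 - + 4 * N) * g0)
      identity = solve-∀

  -- Since 1 + z + z³ + z⁴ = (1 + z³)(1 + z), G n e = Σ_{i≤n} C(n,i) C(n, e-3i).
  twoBinomial : ℕ → ℤ → ℤ
  twoBinomial n e = ΣZ (suc n) (λ i → + (n C i) * choose n (e - + (3 ℕ.* i)))

  -- twoBinomial obeys the recursion defining G: Pascal's rule applied to both binomial factors.
  twoBinomial-step : ∀ n e → twoBinomial (suc n) e ≡ times-steps (twoBinomial n) e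
  twoBinomial-step n e = begin
    ΣZ (suc (suc n)) (λ i → + (suc n C i) * choose (suc n) (e - + (3 ℕ.* i)))
      ≡⟨ ΣZ-pascal n (λ i → choose (suc n) (e - + (3 ℕ.* i))) ⟩
    ΣZ (suc n) (λ i → + (n C i) * choose (suc n) (e - + (3 ℕ.* i)))
      + ΣZ (suc n) (λ i → + (n C i) * choose (suc n) (e - + (3 ℕ.* suc i)))
      ≡⟨ cong₂ _+_ (expand e (λ _ → refl)) (expand (down 3 e) (λ i → cong (choose (suc n)) (shift₃ i))) ⟩
    (H e + H (down 1 e)) + (H (down 3 e) + H (down 4 e))
      ≡⟨ ℤP.+-assoc (H e + H (down 1 e)) (H (down 3 e)) (H (down 4 e)) ⟨
    H e + H (down 1 e) + H (down 3 e) + H (down 4 e) ∎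
    where
    open ≡-Reasoning
    H : ℤ → ℤ
    H = twoBinomial n
    shift₃ : ∀ i → e - + (3 ℕ.* suc i) ≡ down 3 e - + (3 ℕ.* i)
    shift₃ i = trans (cong (λ t → e - + t) (ℕP.*-suc 3 i))
                     (trans (regroup e (+ (3 ℕ.* i))) (cong (_- + (3 ℕ.* i)) (sym (down≡ 3 e))))
      where
      regroup : ∀ e T → e - (+ 3 + T) ≡ e - + 3 - T
      regroup = solve-∀
    expand : ∀ a {Y : ℕ → ℤ} → (∀ i → Y i ≡ choose (suc n) (a - + (3 ℕ.* i))) →
             ΣZ (suc n) (λ i → + (n C i) * Y i) ≡ H a + H (down 1 a)
    expand a {Y} Y≡ = begin
      ΣZ (suc n) (λ i → + (n C i) * Y i)  ≡⟨ ΣZ-ext (suc n) (λ i _ → split i) ⟩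
      ΣZ (suc n) (λ i → A i + B i)        ≡⟨ ΣZ-+ (suc n) A B ⟩
      H a + H (down 1 a)                  ∎
      where
      swap : ∀ a T → a - T - 1ℤ ≡ a - 1ℤ - T
      swap = solve-∀
      pascal : ∀ i → choose (suc n) (a - + (3 ℕ.* i))
                     ≡ choose n (a - + (3 ℕ.* i)) + choose n (down 1 a - + (3 ℕ.* i))
      pascal i = trans (choose-pascal n (a - + (3 ℕ.* i)))
                       (cong (λ t → choose n (a - + (3 ℕ.* i)) + choose n t) (swap a _))
      A B : ℕ → ℤ
      A i = + (n C i) * choose n (a - + (3 ℕ.* i))
      B i = + (n C i) * choose n (down 1 a - + (3 ℕ.* i))
      split : ∀ i → + (n C i) * Y i ≡ A i + B i
      split i = trans (cong (+ (n C i) *_) (trans (Y≡ i) (pascal i))) (ℤP.*-distribˡ-+ (+ (n C i)) _ _)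

  twoBinomial≡G : ∀ n e → twoBinomial n e ≡ G n e
  twoBinomial≡G zero    e =
    trans (ℤP.+-identityʳ _) (trans (ℤP.*-identityˡ _) (cong (choose 0) (ℤP.+-identityʳ e)))
  twoBinomial≡G (suc n) e = trans (twoBinomial-step n e)
    (cong₂ _+_ (cong₂ _+_ (cong₂ _+_ (twoBinomial≡G n e) (twoBinomial≡G n (down 1 e)))
                          (twoBinomial≡G n (down 3 e)))
               (twoBinomial≡G n (down 4 e)))

  sum2≡S : ∀ n → + sum2 n ≡ S n
  sum2≡S n = begin
    + sum2 n
      ≡⟨ +-sum term (upTo (suc n)) ⟩
    sumℤ (map (λ i → + term i) (upTo (suc n)))
      ≡⟨ cong sumℤ (map-applyUpTo id (λ i → + term i) (suc n)) ⟩
    ΣZ (suc n) (λ i → + term i)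
      ≡⟨ ΣZ-ext (suc n) (λ i _ → trans (ℤP.pos-* (n C i) _)
                                       (cong (λ t → + (n C i) * choose n (t - + (3 ℕ.* i))) odd)) ⟩
    twoBinomial n (+ 2 * + n + 1ℤ)
      ≡⟨ twoBinomial≡G n _ ⟩
    S n ∎
    where
    open ≡-Reasoning
    term : ℕ → ℕ
    term i = (n C i) ℕ.* binomℤ n (+ (2 ℕ.* n ℕ.+ 1) - + (3 ℕ.* i))
    odd : + (2 ℕ.* n ℕ.+ 1) ≡ + 2 * + n + 1ℤ
    odd = trans (ℤP.pos-+ (2 ℕ.* n) 1) (cong (_+ 1ℤ) (ℤP.pos-* 2 n))

  sum1≡sum2 : ∀ n → sum1 n ≡ + sum2 n
  sum1≡sum2 n = begin
    sum1 n    ≡⟨ sum1≡L n ⟩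
    L n       ≡⟨ recurrence-unique L-recurrence S-recurrence refl refl n ⟩
    S n       ≡⟨ sum2≡S n ⟨
    + sum2 n  ∎
    where open ≡-Reasoning

module NaturalSums where

  open import Level using (Level)
  open import Data.Nat as ℕ using (ℕ; zero; suc; _+_; _*_)
  import Data.Nat.Properties as ℕP
  open import Algebra.Properties.CommutativeSemigroup ℕP.+-commutativeSemigroup using (interchange)
  open import Data.Nat.ListAction using (sum)
  open import Data.Nat.ListAction.Properties using (sum-++)
  open import Data.List using (List; []; _∷_; _++_; map; concatMap; length; filter; downFrom)
  open import Data.List.Properties using (map-++; map-cong; map-∘)
  open import Data.Empty using (⊥-elim)
  open import Relation.Nullary using (Dec; yes; no; ¬_)
  open import Relation.Unary using (Pred; Decidable)
  open import Relation.Binary.PropositionalEquality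

  private
    variable
      a : Level
      A B : Set

  sumOver : List A → (A → ℕ) → ℕ
  sumOver xs f = sum (map f xs)

  sumOver-cong : ∀ (xs : List A) {f g : A → ℕ} → (∀ x → f x ≡ g x) → sumOver xs f ≡ sumOver xs g
  sumOver-cong xs f≗g = cong sum (map-cong f≗g xs)

  sumOver-+ : ∀ (xs : List A) (f g : A → ℕ) → sumOver xs (λ x → f x + g x) ≡ sumOver xs f + sumOver xs g
  sumOver-+ []       f g = refl
  sumOver-+ (x ∷ xs) f g = trans (cong (f x + g x +_) (sumOver-+ xs f g)) (interchange (f x) (g x) _ _)

  sumOver-const : ∀ (xs : List A) c → sumOver xs (λ _ → c) ≡ length xs * c
  sumOver-const []       c = refl
  sumOver-const (x ∷ xs) c = cong (c +_) (sumOver-const xs c)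

  sumOver-comm : ∀ (xs : List A) (ys : List B) (F : A → B → ℕ) →
    sumOver xs (λ x → sumOver ys (F x)) ≡ sumOver ys (λ y → sumOver xs (λ x → F x y))
  sumOver-comm []       ys F = sym (trans (sumOver-const ys 0) (ℕP.*-zeroʳ (length ys)))
  sumOver-comm (x ∷ xs) ys F = trans (cong (sumOver ys (F x) +_) (sumOver-comm xs ys F))
                                     (sym (sumOver-+ ys (F x) (λ y → sumOver xs (λ x′ → F x′ y))))

  sumOver-concatMap : ∀ (g : A → List B) xs (f : B → ℕ) →
    sumOver (concatMap g xs) f ≡ sumOver xs (λ x → sumOver (g x) f)
  sumOver-concatMap g []       f = refl
  sumOver-concatMap g (x ∷ xs) f = begin
    sum (map f (g x ++ concatMap g xs))
      ≡⟨ cong sum (map-++ f (g x) (concatMap g xs)) ⟩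
    sum (map f (g x) ++ map f (concatMap g xs))
      ≡⟨ sum-++ (map f (g x)) _ ⟩
    sumOver (g x) f + sumOver (concatMap g xs) f
      ≡⟨ cong (sumOver (g x) f +_) (sumOver-concatMap g xs f) ⟩
    sumOver (g x) f + sumOver xs (λ x → sumOver (g x) f) ∎
    where open ≡-Reasoning

  sumOver-map : ∀ (g : A → B) xs (f : B → ℕ) → sumOver (map g xs) f ≡ sumOver xs (λ x → f (g x))
  sumOver-map g xs f = cong sum (sym (map-∘ xs))

  𝟙 : {P : Set a} → Dec P → ℕ
  𝟙 (yes _) = 1
  𝟙 (no _)  = 0

  length-filter : ∀ {P : Pred A a} (P? : Decidable P) xs → length (filter P? xs) ≡ sumOver xs (λ x → 𝟙 (P? x))
  length-filter P? []       = refl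
  length-filter P? (x ∷ xs) with P? x
  ... | yes _ = cong suc (length-filter P? xs)
  ... | no _  = length-filter P? xs

  count-none : ∀ n {P : Pred ℕ a} (P? : Decidable P) → (∀ k → k ℕ.< n → ¬ P k) →
    sumOver (downFrom n) (λ k → 𝟙 (P? k)) ≡ 0
  count-none zero    P? none = refl
  count-none (suc n) P? none with P? n
  ... | yes Pn = ⊥-elim (none n (ℕP.n<1+n n) Pn)
  ... | no _   = count-none n P? (λ k k<n → none k (ℕP.m<n⇒m<1+n k<n))

  count-unique : ∀ n {P : Pred ℕ a} (P? : Decidable P) k₀ → k₀ ℕ.< n → P k₀ →
    (∀ k → k ℕ.< n → P k → k ≡ k₀) → sumOver (downFrom n) (λ k → 𝟙 (P? k)) ≡ 1
  count-unique (suc n) P? k₀ k₀<n+1 Pk₀ unique with P? n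
  ... | yes Pn = cong suc (count-none n P? (λ k k<n Pk → ℕP.<-irrefl
                  (trans (unique k (ℕP.m<n⇒m<1+n k<n) Pk) (sym (unique n (ℕP.n<1+n n) Pn))) k<n))
  ... | no ¬Pn = count-unique n P? k₀ (ℕP.≤∧≢⇒< (ℕP.≤-pred k₀<n+1) (λ k₀≡n → ¬Pn (subst _ k₀≡n Pk₀))) Pk₀
                   (λ k k<n → unique k (ℕP.m<n⇒m<1+n k<n))

module CycleLemma where

  open import Data.Nat as ℕ using (ℕ; zero; suc; s≤s; z≤n)
  import Data.Nat.Properties as ℕP
  open import Data.Integer using (ℤ; +≤+; 0ℤ; 1ℤ; -_; _+_; _-_; _<_; _≤_; _≤?_) renaming (suc to sucℤ)
  import Data.Integer.Properties as ℤP
  open import Data.Integer.Tactic.RingSolver using (solve-∀)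
  open import Data.List using (List; []; _∷_; _++_; [_]; take; drop; length)
  import Data.List.Properties as LP
  open import Data.Product using (Σ-syntax; _×_; _,_; proj₁; proj₂)
  open import Data.Sum using (inj₁; inj₂)
  open import Data.Unit using (⊤; tt)
  open import Data.Empty using (⊥-elim)
  open import Relation.Nullary using (yes; no; ¬_)
  open import Relation.Binary.Definitions using (tri<; tri≈; tri>)
  open import Relation.Binary.PropositionalEquality hiding ([_])
  open import Defs using (sumℤ)

  0<d⇒a<a+d : ∀ a {d} → 0ℤ < d → a < a + d
  0<d⇒a<a+d a 0<d = subst (_< a + _) (ℤP.+-identityʳ a) (ℤP.+-monoʳ-< a 0<d)

  a<a+d⇒0<d : ∀ a {d} → a < a + d → 0ℤ < d
  a<a+d⇒0<d a {d} a<a+d = subst₂ _<_ (ℤP.+-inverseˡ a) (cancel a d) (ℤP.+-monoʳ-< (- a) a<a+d)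
    where
    cancel : ∀ a d → - a + (a + d) ≡ d
    cancel = solve-∀

  private
    1+b≡a+[1-a+b] : ∀ a b → 1ℤ + b ≡ a + (1ℤ - a + b)
    1+b≡a+[1-a+b] = solve-∀

  ≤⇒0<1-a+b : ∀ {a b} → a ≤ b → 0ℤ < 1ℤ - a + b
  ≤⇒0<1-a+b {a} {b} a≤b = a<a+d⇒0<d a (subst (a <_) (1+b≡a+[1-a+b] a b) (ℤP.suc[i]≤j⇒i<j (ℤP.suc-mono a≤b)))

  0<1-a+b⇒≤ : ∀ {a b} → 0ℤ < 1ℤ - a + b → a ≤ b
  0<1-a+b⇒≤ {a} {b} pos = ℤP.≮⇒≥ (λ b<a → ℤP.≤⇒≯ (ℤP.i<j⇒suc[i]≤j b<a) a<1+b)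
    where
    a<1+b : a < sucℤ b
    a<1+b = subst (a <_) (sym (1+b≡a+[1-a+b] a b)) (0<d⇒a<a+d a pos)

  PositiveFrom : ℤ → List ℤ → Set
  PositiveFrom h []       = ⊤
  PositiveFrom h (x ∷ xs) = 0ℤ < h + x × PositiveFrom (h + x) xs

  sumℤ-++ : ∀ xs ys → sumℤ (xs ++ ys) ≡ sumℤ xs + sumℤ ys
  sumℤ-++ []       ys = sym (ℤP.+-identityˡ _)
  sumℤ-++ (x ∷ xs) ys = trans (cong (λ t → x + t) (sumℤ-++ xs ys)) (sym (ℤP.+-assoc x _ _))

  PositiveFrom-++⁻ : ∀ h xs ys → PositiveFrom h (xs ++ ys) → PositiveFrom h xs × PositiveFrom (h + sumℤ xs) ys
  PositiveFrom-++⁻ h []       ys p = tt , subst (λ z → PositiveFrom z ys) (sym (ℤP.+-identityʳ h)) p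
  PositiveFrom-++⁻ h (x ∷ xs) ys (0<h+x , p) with PositiveFrom-++⁻ (h + x) xs ys p
  ... | pxs , pys = (0<h+x , pxs) , subst (λ z → PositiveFrom z ys) (ℤP.+-assoc h x (sumℤ xs)) pys

  PositiveFrom-++⁺ : ∀ h xs ys → PositiveFrom h xs → PositiveFrom (h + sumℤ xs) ys → PositiveFrom h (xs ++ ys)
  PositiveFrom-++⁺ h []       ys tt          pys = subst (λ z → PositiveFrom z ys) (ℤP.+-identityʳ h) pys
  PositiveFrom-++⁺ h (x ∷ xs) ys (0<h+x , pxs) pys =
    0<h+x , PositiveFrom-++⁺ (h + x) xs ys pxs
              (subst (λ z → PositiveFrom z ys) (sym (ℤP.+-assoc h x (sumℤ xs))) pys)

  prefix : List ℤ → ℕ → ℤ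
  prefix xs t = sumℤ (take t xs)

  PrefixesPositive : ℤ → List ℤ → Set
  PrefixesPositive h xs = ∀ t → 0 ℕ.< t → t ℕ.≤ length xs → 0ℤ < h + prefix xs t

  positive⇒prefixes : ∀ h xs → PositiveFrom h xs → PrefixesPositive h xs
  positive⇒prefixes h (x ∷ xs) (p , _)  (suc zero)    _ _ = subst (0ℤ <_) (cong (λ t → h + t) (sym (ℤP.+-identityʳ x))) p
  positive⇒prefixes h (x ∷ xs) (_ , ps) (suc (suc t)) _ (s≤s t<len) =
    subst (0ℤ <_) (ℤP.+-assoc h x _) (positive⇒prefixes (h + x) xs ps (suc t) (s≤s z≤n) t<len)

  prefixes⇒positive : ∀ h xs → PrefixesPositive h xs → PositiveFrom h xs
  prefixes⇒positive h []       pp = tt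
  prefixes⇒positive h (x ∷ xs) pp =
    subst (0ℤ <_) (cong (λ t → h + t) (ℤP.+-identityʳ x)) (pp 1 (s≤s z≤n) (s≤s z≤n)) ,
    prefixes⇒positive (h + x) xs (λ t _ t≤len →
      subst (0ℤ <_) (sym (ℤP.+-assoc h x _)) (pp (suc t) (s≤s z≤n) (s≤s t≤len)))

  prefix-+ : ∀ k t xs → prefix xs (k ℕ.+ t) ≡ prefix xs k + prefix (drop k xs) t
  prefix-+ zero    t xs       = sym (ℤP.+-identityˡ _)
  prefix-+ (suc k) t []       = sym (cong (λ ys → 0ℤ + sumℤ ys) (LP.take-[] t))
  prefix-+ (suc k) t (x ∷ xs) = trans (cong (λ t → x + t) (prefix-+ k t xs)) (sym (ℤP.+-assoc x _ _))

  prefix-take : ∀ {u k} xs → u ℕ.≤ k → prefix (take k xs) u ≡ prefix xs u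
  prefix-take {u} {k} xs u≤k = cong sumℤ (trans (LP.take-take u k xs) (cong (λ m → take m xs) (ℕP.m≤n⇒m⊓n≡m u≤k)))

  rotate : ℕ → List ℤ → List ℤ
  rotate k xs = drop k xs ++ take k xs

  rotate-one : List ℤ → List ℤ
  rotate-one []       = []
  rotate-one (x ∷ xs) = xs ++ [ x ]

  split-at : ∀ k xs → k ℕ.< length xs →
             Σ[ x ∈ ℤ ] drop k xs ≡ x ∷ drop (suc k) xs × take (suc k) xs ≡ take k xs ++ [ x ]
  split-at zero    (x ∷ xs) _           = x , refl , refl
  split-at (suc k) (y ∷ xs) (s≤s k<len) with split-at k xs k<len
  ... | x , drop≡ , take≡ = x , drop≡ , cong (y ∷_) take≡

  rotate-suc : ∀ k xs → k ℕ.< length xs → rotate-one (rotate k xs) ≡ rotate (suc k) xs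
  rotate-suc k xs k<len with split-at k xs k<len
  ... | x , drop≡ , take≡ rewrite drop≡ | take≡ = LP.++-assoc (drop (suc k) xs) (take k xs) [ x ]

  sum-rotate-one : ∀ xs → sumℤ (rotate-one xs) ≡ sumℤ xs
  sum-rotate-one []       = refl
  sum-rotate-one (x ∷ xs) =
    trans (sumℤ-++ xs [ x ]) (trans (cong (λ t → sumℤ xs + t) (ℤP.+-identityʳ x)) (ℤP.+-comm (sumℤ xs) x))

  LastMinimum : (ℕ → ℤ) → ℕ → ℕ → Set
  LastMinimum S M k = (∀ j → k ℕ.< j → j ℕ.≤ M → S k < S j) × (∀ u → u ℕ.≤ k → S k ≤ S u)

  lastMinimum-minimal : ∀ {S M k} → LastMinimum S M k → ∀ u → u ℕ.≤ M → S k ≤ S u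
  lastMinimum-minimal {k = k} (later , earlier) u u≤M with u ℕ.≤? k
  ... | yes u≤k = earlier u u≤k
  ... | no  u≰k = ℤP.<⇒≤ (later u (ℕP.≰⇒> u≰k) u≤M)

  lastMinimum-exists : ∀ S M → Σ[ k ∈ ℕ ] k ℕ.≤ M × LastMinimum S M k
  lastMinimum-exists S zero =
    0 , z≤n , (λ j 0<j j≤0 → ⊥-elim (ℕP.<⇒≱ 0<j j≤0)) ,
    (λ u u≤0 → ℤP.≤-reflexive (cong S (sym (ℕP.n≤0⇒n≡0 u≤0))))
  lastMinimum-exists S (suc M) with lastMinimum-exists S M
  ... | k , k≤M , lm with S (suc M) ≤? S k
  ...   | yes S[M+1]≤Sk = suc M , ℕP.≤-refl , (λ j M+1<j j≤M+1 → ⊥-elim (ℕP.<⇒≱ M+1<j j≤M+1)) , newMinimum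
    where
    newMinimum : ∀ u → u ℕ.≤ suc M → S (suc M) ≤ S u
    newMinimum u u≤M+1 with ℕP.m≤n⇒m<n∨m≡n u≤M+1
    ... | inj₁ u<M+1 = ℤP.≤-trans S[M+1]≤Sk (lastMinimum-minimal lm u (ℕP.≤-pred u<M+1))
    ... | inj₂ refl  = ℤP.≤-refl
  ...   | no S[M+1]≰Sk = k , ℕP.m≤n⇒m≤1+n k≤M , later , proj₂ lm
    where
    later : ∀ j → k ℕ.< j → j ℕ.≤ suc M → S k < S j
    later j k<j j≤M+1 with ℕP.m≤n⇒m<n∨m≡n j≤M+1
    ... | inj₁ j<M+1 = proj₁ lm j k<j (ℕP.≤-pred j<M+1)
    ... | inj₂ refl  = ℤP.≰⇒> S[M+1]≰Sk

  lastMinimum-unique : ∀ {S M k k′} → k ℕ.≤ M → k′ ℕ.≤ M → LastMinimum S M k → LastMinimum S M k′ → k ≡ k′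
  lastMinimum-unique {k = k} {k′} k≤M k′≤M lm lm′ with ℕP.<-cmp k k′
  ... | tri< k<k′ _ _ = ⊥-elim (ℤP.<⇒≱ (proj₁ lm k′ k<k′ k′≤M) (proj₂ lm′ k (ℕP.<⇒≤ k<k′)))
  ... | tri≈ _ k≡k′ _ = k≡k′
  ... | tri> _ _ k′<k = ⊥-elim (ℤP.<⇒≱ (proj₁ lm′ k k′<k k≤M) (proj₂ lm k′ (ℕP.<⇒≤ k′<k)))

  module _ (xs : List ℤ) (total : sumℤ xs ≡ 1ℤ) where

    private
      S : ℕ → ℤ
      S = prefix xs

      N : ℕ
      N = length xs

      S-N : S N ≡ 1ℤ
      S-N = trans (cong sumℤ (LP.take-all N xs ℕP.≤-refl)) total

      sum-drop : ∀ k → sumℤ (drop k xs) ≡ 1ℤ - S k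
      sum-drop k = trans (cancel (S k) (sumℤ (drop k xs)))
        (cong (_- S k) (trans (sym (sumℤ-++ (take k xs) (drop k xs))) (trans (cong sumℤ (LP.take++drop≡id k xs)) total)))
        where
        cancel : ∀ p d → d ≡ p + d - p
        cancel = solve-∀

      length-take-≤ : ∀ {k} → k ℕ.≤ N → length (take k xs) ≡ k
      length-take-≤ {k} k≤N = trans (LP.length-take k xs) (ℕP.m≤n⇒m⊓n≡m k≤N)

      length-drop : ∀ k → length (drop k xs) ≡ N ℕ.∸ k
      length-drop k = LP.length-drop k xs

    -- The rotation by k stays positive exactly when k is the last minimum of the prefix sums:
    -- its first part visits S j - S k for k < j ≤ N, its second part 1 - S k + S u for u ≤ k.
    rotation⇒lastMinimum : ∀ k → k ℕ.< N → PositiveFrom 0ℤ (rotate k xs) → LastMinimum S N k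
    rotation⇒lastMinimum k k<N pos = later , earlier
      where
      parts : PositiveFrom 0ℤ (drop k xs) × PositiveFrom (0ℤ + sumℤ (drop k xs)) (take k xs)
      parts = PositiveFrom-++⁻ 0ℤ (drop k xs) (take k xs) pos
      later : ∀ j → k ℕ.< j → j ℕ.≤ N → S k < S j
      later j k<j j≤N = subst (S k <_) Sj≡
        (0<d⇒a<a+d (S k) (subst (0ℤ <_) (ℤP.+-identityˡ _)
          (positive⇒prefixes 0ℤ (drop k xs) (proj₁ parts) (j ℕ.∸ k) (ℕP.m<n⇒0<n∸m k<j)
            (subst (j ℕ.∸ k ℕ.≤_) (sym (length-drop k)) (ℕP.∸-monoˡ-≤ k j≤N)))))
        where
        Sj≡ : S k + prefix (drop k xs) (j ℕ.∸ k) ≡ S j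
        Sj≡ = trans (sym (prefix-+ k (j ℕ.∸ k) xs)) (cong S (ℕP.m+[n∸m]≡n (ℕP.<⇒≤ k<j)))
      earlier : ∀ u → u ℕ.≤ k → S k ≤ S u
      earlier zero    _   = ℤP.i<j⇒i≤pred[j] (subst (S k <_) S-N (later N k<N ℕP.≤-refl))
      earlier (suc u) u<k = 0<1-a+b⇒≤
        (subst (0ℤ <_) (cong₂ _+_ (trans (ℤP.+-identityˡ _) (sum-drop k)) (prefix-take xs u<k))
          (positive⇒prefixes (0ℤ + sumℤ (drop k xs)) (take k xs) (proj₂ parts) (suc u) (s≤s z≤n)
            (subst (suc u ℕ.≤_) (sym (length-take-≤ (ℕP.<⇒≤ k<N))) u<k)))

    lastMinimum⇒rotation : ∀ k → k ℕ.< N → LastMinimum S N k → PositiveFrom 0ℤ (rotate k xs)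
    lastMinimum⇒rotation k k<N (later , earlier) = PositiveFrom-++⁺ 0ℤ (drop k xs) (take k xs) first second
      where
      first : PositiveFrom 0ℤ (drop k xs)
      first = prefixes⇒positive 0ℤ (drop k xs) (λ t 0<t t≤len →
        subst (0ℤ <_) (sym (ℤP.+-identityˡ _))
          (a<a+d⇒0<d (S k) (subst (S k <_) (prefix-+ k t xs)
            (later (k ℕ.+ t) (ℕP.m<m+n k 0<t)
              (subst (k ℕ.+ t ℕ.≤_) (ℕP.m+[n∸m]≡n (ℕP.<⇒≤ k<N))
                (ℕP.+-monoʳ-≤ k (subst (t ℕ.≤_) (length-drop k) t≤len)))))))
      second : PositiveFrom (0ℤ + sumℤ (drop k xs)) (take k xs)
      second = prefixes⇒positive (0ℤ + sumℤ (drop k xs)) (take k xs) (λ u _ u≤len →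
        let u≤k = subst (u ℕ.≤_) (length-take-≤ (ℕP.<⇒≤ k<N)) u≤len in
        subst (0ℤ <_) (sym (cong₂ _+_ (trans (ℤP.+-identityˡ _) (sum-drop k)) (prefix-take xs u≤k)))
          (≤⇒0<1-a+b (earlier u u≤k)))

    cycle-lemma : Σ[ k ∈ ℕ ] k ℕ.< N × PositiveFrom 0ℤ (rotate k xs)
                             × (∀ k′ → k′ ℕ.< N → PositiveFrom 0ℤ (rotate k′ xs) → k′ ≡ k)
    cycle-lemma with lastMinimum-exists S N
    ... | k , k≤N , lm = k , k<N , lastMinimum⇒rotation k k<N lm ,
                         λ k′ k′<N pos → lastMinimum-unique (ℕP.<⇒≤ k′<N) k≤N (rotation⇒lastMinimum k′ k′<N pos) lm
      where
      1≰0 : ¬ (1ℤ ≤ 0ℤ)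
      1≰0 (+≤+ ())
      k<N : k ℕ.< N
      k<N = ℕP.≤∧≢⇒< k≤N (λ k≡N → 1≰0 (subst (_≤ 0ℤ) S-N (subst (λ m → S m ≤ 0ℤ) k≡N (proj₂ lm 0 z≤n))))

module Walks where

  open import Data.Nat as ℕ using (ℕ; zero; suc)
  import Data.Nat.Properties as ℕP
  open import Data.Integer as ℤ using (ℤ; +_; -[1+_]; 0ℤ; 1ℤ; _+_; _-_; _*_)
  import Data.Integer.Properties as ℤP
  open import Data.Integer.Tactic.RingSolver using (solve-∀)
  open import Data.List using (List; [_]; map; length; downFrom)
  import Data.List.Properties as LP
  open import Data.Vec using ([]; _∷_; _∷ʳ_; toList)
  import Data.Vec.Properties as VP
  open import Data.Product using (_×_; _,_; proj₁; proj₂)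
  open import Relation.Nullary using (Dec; yes; no)
  open import Data.Empty using (⊥-elim)
  open import Relation.Binary.PropositionalEquality hiding ([_])
  open import Defs
  open NaturalSums
  open CycleLemma
  open Binomial using (choose)
  open SecondSum using (G; S)
  open IntegerSums using (+suc; down; down≡; +-sum)

  Σw : ∀ n → (Walk n → ℕ) → ℕ
  Σw n f = sumOver (allWalks n) f

  Σw-cons : ∀ n (f : Walk (suc n) → ℕ) → Σw (suc n) f ≡ sumOver allSteps (λ s → Σw n (λ w → f (s ∷ w)))
  Σw-cons n f = trans (sumOver-concatMap (λ s → map (s ∷_) (allWalks n)) allSteps f)
                      (sumOver-cong allSteps (λ s → sumOver-map (s ∷_) (allWalks n) f))

  Σw-snoc : ∀ n (f : Walk (suc n) → ℕ) → Σw (suc n) f ≡ sumOver allSteps (λ s → Σw n (λ w → f (w ∷ʳ s)))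
  Σw-snoc zero    f = Σw-cons zero f
  Σw-snoc (suc n) f = begin
    Σw (suc (suc n)) f
      ≡⟨ Σw-cons (suc n) f ⟩
    sumOver allSteps (λ s → Σw (suc n) (λ w → f (s ∷ w)))
      ≡⟨ sumOver-cong allSteps (λ s → Σw-snoc n (λ w → f (s ∷ w))) ⟩
    sumOver allSteps (λ s → sumOver allSteps (λ t → Σw n (λ w → f (s ∷ (w ∷ʳ t)))))
      ≡⟨ sumOver-comm allSteps allSteps (λ s t → Σw n (λ w → f (s ∷ (w ∷ʳ t)))) ⟩
    sumOver allSteps (λ t → sumOver allSteps (λ s → Σw n (λ w → f (s ∷ (w ∷ʳ t)))))
      ≡⟨ sumOver-cong allSteps (λ t → Σw-cons n (λ w → f (w ∷ʳ t))) ⟨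
    sumOver allSteps (λ t → Σw (suc n) (λ w → f (w ∷ʳ t))) ∎
    where open ≡-Reasoning

  rotate-walk : ∀ {n} → Walk n → Walk n
  rotate-walk []      = []
  rotate-walk (s ∷ w) = w ∷ʳ s

  rotate-walk-by : ∀ {n} → ℕ → Walk n → Walk n
  rotate-walk-by zero    w = w
  rotate-walk-by (suc k) w = rotate-walk (rotate-walk-by k w)

  -- Rotation permutes the walks, so sums over all walks are rotation invariant.
  Σw-rotate : ∀ n (f : Walk n → ℕ) → Σw n (λ w → f (rotate-walk w)) ≡ Σw n f
  Σw-rotate zero    f = refl
  Σw-rotate (suc n) f = trans (Σw-cons n (λ w → f (rotate-walk w))) (sym (Σw-snoc n f))

  Σw-rotate-by : ∀ n k (f : Walk n → ℕ) → Σw n (λ w → f (rotate-walk-by k w)) ≡ Σw n f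
  Σw-rotate-by n zero    f = refl
  Σw-rotate-by n (suc k) f = trans (Σw-rotate-by n k (λ w → f (rotate-walk w))) (Σw-rotate n f)

  steps : ∀ {n} → Walk n → List ℤ
  steps w = map val (toList w)

  length-steps : ∀ {n} (w : Walk n) → length (steps w) ≡ n
  length-steps w = trans (LP.length-map val (toList w)) (VP.length-toList w)

  PosAfterStart≡PositiveFrom : ∀ {n} h (w : Walk n) → PosAfterStart h w ≡ PositiveFrom h (steps w)
  PosAfterStart≡PositiveFrom h []      = refl
  PosAfterStart≡PositiveFrom h (s ∷ w) = cong (+ 0 ℤ.< h + val s ×_) (PosAfterStart≡PositiveFrom (h + val s) w)

  endAlt≡ : ∀ {n} h (w : Walk n) → endAlt h w ≡ h + sumℤ (steps w)
  endAlt≡ h []      = sym (ℤP.+-identityʳ h)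
  endAlt≡ h (s ∷ w) = trans (endAlt≡ (h + val s) w) (ℤP.+-assoc h (val s) _)

  steps-rotate : ∀ {n} (w : Walk n) → steps (rotate-walk w) ≡ rotate-one (steps w)
  steps-rotate []      = refl
  steps-rotate (s ∷ w) = trans (cong (map val) (VP.toList-∷ʳ s w)) (LP.map-++ val (toList w) [ s ])

  steps-rotate-by : ∀ {n} k (w : Walk n) → k ℕ.≤ n → steps (rotate-walk-by k w) ≡ rotate k (steps w)
  steps-rotate-by zero    w _   = sym (LP.++-identityʳ (steps w))
  steps-rotate-by (suc k) w k<n = begin
    steps (rotate-walk (rotate-walk-by k w))  ≡⟨ steps-rotate (rotate-walk-by k w) ⟩
    rotate-one (steps (rotate-walk-by k w))   ≡⟨ cong rotate-one (steps-rotate-by k w (ℕP.<⇒≤ k<n)) ⟩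
    rotate-one (rotate k (steps w))           ≡⟨ rotate-suc k (steps w) (subst (k ℕ.<_) (sym (length-steps w)) k<n) ⟩
    rotate (suc k) (steps w)                  ∎
    where open ≡-Reasoning

  endAlt-rotate-by : ∀ {n} h k (w : Walk n) → endAlt h (rotate-walk-by k w) ≡ endAlt h w
  endAlt-rotate-by h zero    w = refl
  endAlt-rotate-by h (suc k) w = begin
    endAlt h (rotate-walk v)              ≡⟨ endAlt≡ h (rotate-walk v) ⟩
    h + sumℤ (steps (rotate-walk v))      ≡⟨ cong (λ xs → h + sumℤ xs) (steps-rotate v) ⟩
    h + sumℤ (rotate-one (steps v))       ≡⟨ cong (λ t → h + t) (sum-rotate-one (steps v)) ⟩
    h + sumℤ (steps v)                    ≡⟨ endAlt≡ h v ⟨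
    endAlt h v                            ≡⟨ endAlt-rotate-by h k w ⟩
    endAlt h w                            ∎
    where
    open ≡-Reasoning
    v : Walk _
    v = rotate-walk-by k w

  Bridge : ∀ {n} → Walk n → Set
  Bridge w = endAlt (+ 0) w ≡ + 1

  bridge? : ∀ {n} (w : Walk n) → Dec (Bridge w)
  bridge? w = endAlt (+ 0) w ℤ.≟ + 1

  good-rotations : ∀ n (w : Walk n) →
    sumOver (downFrom n) (λ k → 𝟙 (good? (rotate-walk-by k w))) ≡ 𝟙 (bridge? w)
  good-rotations n w with bridge? w
  ... | no ¬bridge = count-none n (λ k → good? (rotate-walk-by k w))
                       (λ k _ good → ¬bridge (trans (sym (endAlt-rotate-by (+ 0) k w)) (proj₂ good)))
  ... | yes bridge with cycle-lemma (steps w) (trans (sym (ℤP.+-identityˡ _)) (trans (sym (endAlt≡ (+ 0) w)) bridge))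
  ...   | k₀ , k₀<N , positive , unique =
    count-unique n (λ k → good? (rotate-walk-by k w)) k₀ k₀<n (good-at k₀<n positive)
      (λ k k<n good → unique k (subst (k ℕ.<_) (sym (length-steps w)) k<n) (positive-at k<n (proj₁ good)))
    where
    k₀<n : k₀ ℕ.< n
    k₀<n = subst (k₀ ℕ.<_) (length-steps w) k₀<N
    positive-at : ∀ {k} → k ℕ.< n →
                  PosAfterStart (+ 0) (rotate-walk-by k w) → PositiveFrom 0ℤ (rotate k (steps w))
    positive-at {k} k<n pos = subst (PositiveFrom 0ℤ) (steps-rotate-by k w (ℕP.<⇒≤ k<n))
                                (subst (λ A → A) (PosAfterStart≡PositiveFrom (+ 0) (rotate-walk-by k w)) pos)
    good-at : ∀ {k} → k ℕ.< n → PositiveFrom 0ℤ (rotate k (steps w)) → Good (rotate-walk-by k w)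
    good-at {k} k<n pos =
      subst (λ A → A) (sym (PosAfterStart≡PositiveFrom (+ 0) (rotate-walk-by k w)))
            (subst (PositiveFrom 0ℤ) (sym (steps-rotate-by k w (ℕP.<⇒≤ k<n))) pos) ,
      trans (endAlt-rotate-by (+ 0) k w) bridge

  bridges : ℕ → ℤ → ℕ
  bridges n h = Σw n (λ w → 𝟙 (endAlt h w ℤ.≟ + 1))

  -- Summing the cycle lemma over all walks: n · numWalks n is the number of bridges of length n.
  rotation-count : ∀ n → n ℕ.* numWalks n ≡ bridges n (+ 0)
  rotation-count n = begin
    n ℕ.* numWalks n
      ≡⟨ cong (n ℕ.*_) (length-filter good? (allWalks n)) ⟩
    n ℕ.* Σw n (λ w → 𝟙 (good? w))
      ≡⟨ trans (cong (ℕ._* Σw n (λ w → 𝟙 (good? w))) (sym (LP.length-downFrom n)))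
               (sym (sumOver-const (downFrom n) _)) ⟩
    sumOver (downFrom n) (λ _ → Σw n (λ w → 𝟙 (good? w)))
      ≡⟨ sumOver-cong (downFrom n) (λ k → Σw-rotate-by n k (λ w → 𝟙 (good? w))) ⟨
    sumOver (downFrom n) (λ k → Σw n (λ w → 𝟙 (good? (rotate-walk-by k w))))
      ≡⟨ sumOver-comm (downFrom n) (allWalks n) (λ k w → 𝟙 (good? (rotate-walk-by k w))) ⟩
    Σw n (λ w → sumOver (downFrom n) (λ k → 𝟙 (good? (rotate-walk-by k w))))
      ≡⟨ sumOver-cong (allWalks n) (good-rotations n) ⟩
    bridges n (+ 0) ∎
    where open ≡-Reasoning

  unit-off : ∀ {x} → x ≢ 0ℤ → choose 0 x ≡ 0ℤ
  unit-off {+ zero}   x≢0 = ⊥-elim (x≢0 refl)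
  unit-off {+ suc k}  _   = refl
  unit-off { -[1+ k ]} _  = refl

  -- Counting bridges by their first step: the number of bridges of length n from altitude h is the
  -- coefficient of z^(1-h+2n) in (1 + z + z³ + z⁴)^n.
  bridges≡G : ∀ n h → + bridges n h ≡ G n (+ 1 - h + + 2 * + n)
  bridges≡G zero    h with endAlt h [] ℤ.≟ + 1
  ... | yes refl = refl
  ... | no h≢1   = sym (unit-off (λ e → h≢1 (solve-for-h h e)))
    where
    solve-for-h : ∀ h → + 1 - h + + 2 * + 0 ≡ 0ℤ → h ≡ + 1
    solve-for-h h e = trans (isolate h) (cong (λ t → + 1 - t) e)
      where
      isolate : ∀ h → h ≡ + 1 - (+ 1 - h + + 2 * + 0)
      isolate = solve-∀
  bridges≡G (suc n) h = begin
    + bridges (suc n) h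
      ≡⟨ cong +_ (Σw-cons n (λ w → 𝟙 (endAlt h w ℤ.≟ + 1))) ⟩
    + (b m2 ℕ.+ (b m1 ℕ.+ (b p1 ℕ.+ (b p2 ℕ.+ 0))))
      ≡⟨ trans (+-sum b allSteps) (regroup (+ b m2) (+ b m1) (+ b p1) (+ b p2)) ⟩
    + b m2 + + b m1 + + b p1 + + b p2
      ≡⟨ cong₂ _+_ (cong₂ _+_ (cong₂ _+_ (first-step m2 0 refl) (first-step m1 1 refl))
                              (first-step p1 3 refl)) (first-step p2 4 refl) ⟩
    G (suc n) e ∎
    where
    open ≡-Reasoning
    b : Step → ℕ
    b s = bridges n (h + val s)
    e : ℤ
    e = + 1 - h + + 2 * + suc n
    regroup : ∀ a b c d → a + (b + (c + (d + 0ℤ))) ≡ a + b + c + d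
    regroup = solve-∀
    first-step : ∀ s k → val s ≡ + k - + 2 → + b s ≡ G n (down k e)
    first-step s k val≡ = trans (bridges≡G n (h + val s)) (cong (G n) (begin
      + 1 - (h + val s) + + 2 * + n       ≡⟨ cong (λ v → + 1 - (h + v) + + 2 * + n) val≡ ⟩
      + 1 - (h + (+ k - + 2)) + + 2 * + n  ≡⟨ shift h (+ n) (+ k) ⟩
      + 1 - h + + 2 * (+ n + 1ℤ) - + k     ≡⟨ cong (λ t → + 1 - h + + 2 * t - + k) (sym (+suc n)) ⟩
      e - + k                              ≡⟨ down≡ k e ⟨
      down k e                             ∎))
      where
      shift : ∀ h N K → + 1 - (h + (K - + 2)) + + 2 * N ≡ + 1 - h + + 2 * (N + 1ℤ) - K
      shift = solve-∀

  n·numWalks≡S : ∀ n → + n * + numWalks n ≡ S n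
  n·numWalks≡S n = begin
    + n * + numWalks n             ≡⟨ ℤP.pos-* n (numWalks n) ⟨
    + (n ℕ.* numWalks n)           ≡⟨ cong +_ (rotation-count n) ⟩
    + bridges n (+ 0)              ≡⟨ bridges≡G n (+ 0) ⟩
    G n (+ 1 - + 0 + + 2 * + n)    ≡⟨ cong (G n) (regroup (+ n)) ⟩
    S n                            ∎
    where
    open ≡-Reasoning
    regroup : ∀ N → + 1 - + 0 + + 2 * N ≡ + 2 * N + 1ℤ
    regroup = solve-∀

open import Defs
open import Data.Nat using (ℕ; _≤_)
open import Data.Integer using (+_; _*_)
open import Data.Product using (_×_; _,_)
open import Relation.Binary.PropositionalEquality using (_≡_; trans; sym)
open SecondSum using (sum1≡sum2; sum2≡S)
open Walks using (n·numWalks≡S)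

mainTheorem8 : (n : ℕ) → 1 ≤ n →
    ((+ n) * (+ numWalks n) ≡ sum1 n) × ((+ n) * (+ numWalks n) ≡ + sum2 n)
mainTheorem8 n _ = trans counted (sym (sum1≡sum2 n)) , counted
  where
  counted : + n * + numWalks n ≡ + sum2 n
  counted = trans (n·numWalks≡S n) (sym (sum2≡S n))
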